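{- Let $A,B$ be arrow types, and write $Rep(A)=\forall\mathbf v(A_g\rightarrow A_d)$ and $Rep(B)=\forall\mathbf v'(B_g\rightarrow B_d)$. If $A\subseteq B$, then there is a sequence $\mathbf G$ of terms and/or formulas such that $B_g\subseteq A_g[\mathbf G/\mathbf v]$ and $A_d[\mathbf G/\mathbf v]\subseteq B_d$.
   Context: Formulas. Second-order language with individual variables, function symbols (building terms), predicate symbols and predicate variables of every arity, logical symbols $\perp,\rightarrow,\forall,\mu$. Formulas: $\perp$; atomic $X(t_1,\dots,t_n)$; $A\rightarrow B$; $\forall xA$; $\forall XA$; $\mu Cx_1\dots x_nA\langle t_1,\dots,t_n\rangle$ with $C$ an $n$-ary predicate symbol appearing and positive in $A$ ($C,\bar x$ bound). Positivity of $X$ in $A$: not appearing: both; in $X(\bar t)$: positive only; in $B\rightarrow C$: positive (negative) iff negative (positive) in $B$ and positive (negative) in $C$; in $\forall vB$ ($v\ne X$) and $\mu C\bar xB\langle\bar t\rangle$: as in $B$. $A[G/X(x_1,\dots,x_n)]$ replaces each $X(t_1,\dots,t_n)$ by $G[t_1/x_1,\dots,t_n/x_n]$; $A[\mathbf G/\mathbf v]$ is simultaneous substitution of the terms/formulas $\mathbf G$ for the variables $\mathbf v$ (of matching kinds). Relation $\subseteq$ (fixed set $\mathbf E$ of equations between terms; a particular case of an equation of $\mathbf E$ is $u=v$ or $v=u$ with $u,v$ obtained from the two sides of an equation of $\mathbf E$ by one substitution of terms for individual variables): the least relation closed under (ax) $A\subseteq A$; from $A\subseteq A'$, $B\subseteq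 B'$ infer $A'\rightarrow B\subseteq A\rightarrow B'$; from $A[G/v]\subseteq B$ infer $\forall vA\subseteq B$ ($G$ a term if $v$ is an individual variable, a formula if $v$ is a predicate variable); from $A\subseteq B$ infer $A\subseteq\forall vB$ if $v$ not free in $A$; from $A\subseteq B[u/y]$ infer $A\subseteq B[w/y]$ if $u=w$ is a particular case of an equation of $\mathbf E$; transitivity; ($\mu_d$) $D[\mu Cx_1\dots x_mD\langle z_1,\dots,z_m\rangle/C(z_1,\dots,z_m)][t_1/x_1,\dots,t_m/x_m]\subseteq\mu Cx_1\dots x_mD\langle t_1,\dots,t_m\rangle$; ($\mu'_g$) its converse; ($\mu_g$) from $D[F/C(x_1,\dots,x_m)]\subseteq F$ infer $\mu Cx_1\dots x_mD\langle t_1,\dots,t_m\rangle\subseteq F[t_1/x_1,\dots,t_m/x_m]$. An arrow type is a formula containing at least one arrow $\rightarrow$. For an arrow type $A$, $Rep(A)$ is defined by induction: $Rep(E\rightarrow F)=E\rightarrow F$; $Rep(\forall vB)=\forall v\,Rep(B)$; $Rep(\mu Cx_1\dots x_nB\langle t_1,\dots,t_n\rangle)=Rep(B)[\mu Cx_1\dots x_nB\langle y_1,\dots,y_n\rangle/C(y_1,\dots,y_n)][t_1/x_1,\dots,t_n/x_n]$. $Rep(A)$ always has the form $\forall\mathbf v(G\rightarrow D)$ for a sequence of variables $\mathbf v$; one writes $A_g=G$, $A_d=D$. -}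

module Defs where

open import Data.Nat using (ℕ; zero; suc; _+_; _≡ᵇ_)
open import Data.Bool using (Bool; true; false; if_then_else_)
open import Data.Vec using (Vec; []; _∷_)
open import Data.List using (List; []; _∷_)
open import Data.List.Relation.Unary.All using (All; []; _∷_)
open import Data.Product using (_×_)
open import Data.Unit using (⊤)
open import Data.Empty using (⊥)
open import Relation.Binary.PropositionalEquality using (_≡_)
open import Relation.Nullary using (¬_)

record Signature : Set₁ where
  field
    Fun  : Set
    arF  : Fun → ℕ
    Pred : Set
    arP  : Pred → ℕ

module Syntax (S : Signature) where
  open Signature S

  data Term : Set where
    var : ℕ → Term
    fn  : (f : Fun) → Vec Term (arF f) → Term

  mutual
    subT : (ℕ → Term) → Term → Term
    subT ρ (var x)   = ρ x
    subT ρ (fn f ts) = fn f (subTs ρ ts)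

    subTs : ∀ {n} → (ℕ → Term) → Vec Term n → Vec Term n
    subTs ρ []       = []
    subTs ρ (t ∷ ts) = subT ρ t ∷ subTs ρ ts

  -- Formulas.
  --  pvar n i ts : the predicate variable of arity n with de Bruijn index i
  --                (indices counted separately for each arity) applied to ts
  --  pcon P ts   : a predicate symbol (constant) applied to ts
  --  ∀ι A        : binds individual variable 0 in A
  --  ∀π n A      : binds the n-ary predicate variable 0 in A
  --  μ n D ts    : μ C x1..xn D ⟨ts⟩; in D, C is the n-ary predicate variable 0
  --                and x1..xn are the individual variables 0..n-1
  --                (outer individual variables are shifted by n).
  data Fm : Set where
    ⊥'   : Fm
    pvar : (n i : ℕ) → Vec Term n → Fm
    pcon : (P : Pred) → Vec Term (arP P) → Fm
    _⇒_  : Fm → Fm → Fm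
    ∀ι   : Fm → Fm
    ∀π   : (n : ℕ) → Fm → Fm
    μ    : (n : ℕ) → Fm → Vec Term n → Fm

  infixr 5 _⇒_

  wk1 : Term → Term
  wk1 = subT (λ x → var (suc x))

  liftι : ℕ → (ℕ → Term) → ℕ → Term
  liftι zero    ρ j       = ρ j
  liftι (suc k) ρ zero    = var zero
  liftι (suc k) ρ (suc j) = wk1 (liftι k ρ j)

  inst : ∀ {n} → Vec Term n → (ℕ → Term) → ℕ → Term
  inst []       ρ j       = ρ j
  inst (u ∷ us) ρ zero    = u
  inst (u ∷ us) ρ (suc j) = inst us ρ j

  shiftι : ℕ → ℕ → Term
  shiftι k j = var (k + j)

  subι : (ℕ → Term) → Fm → Fm
  subι ρ ⊥'            = ⊥'
  subι ρ (pvar n i ts) = pvar n i (subTs ρ ts)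
  subι ρ (pcon P ts)   = pcon P (subTs ρ ts)
  subι ρ (A ⇒ B)       = subι ρ A ⇒ subι ρ B
  subι ρ (∀ι A)        = ∀ι (subι (liftι 1 ρ) A)
  subι ρ (∀π n A)      = ∀π n (subι ρ A)
  subι ρ (μ m D ts)    = μ m (subι (liftι m ρ) D) (subTs ρ ts)

  -- shiftπ b n i : index i of an n-ary predicate variable after passing
  -- a binder of a b-ary predicate variable
  shiftπ : ℕ → ℕ → ℕ → ℕ
  shiftπ b n i = if n ≡ᵇ b then suc i else i

  liftπ : ℕ → (ℕ → ℕ → ℕ) → ℕ → ℕ → ℕ
  liftπ b r n zero    = if n ≡ᵇ b then zero else r n zero
  liftπ b r n (suc i) = if n ≡ᵇ b then suc (r n i) else r n (suc i)

  renπ : (ℕ → ℕ → ℕ) → Fm → Fm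
  renπ r ⊥'            = ⊥'
  renπ r (pvar n i ts) = pvar n (r n i) ts
  renπ r (pcon P ts)   = pcon P ts
  renπ r (A ⇒ B)       = renπ r A ⇒ renπ r B
  renπ r (∀ι A)        = ∀ι (renπ r A)
  renπ r (∀π n A)      = ∀π n (renπ (liftπ n r) A)
  renπ r (μ m D ts)    = μ m (renπ (liftπ m r) D) ts

  -- The image of an n-ary predicate
  -- variable is a "body": a formula whose individual variables 0..n-1 are
  -- the parameters x1..xn (outer variables shifted by n).  Thus
  -- A[G/X(x1..xn)] replaces X(t1..tn) by G[t1/x1..tn/xn].

  record Subst : Set where
    field
      ind : ℕ → Term
      prd : ℕ → ℕ → Fm
  open Subst public

  varsFrom : (n k : ℕ) → Vec Term n
  varsFrom zero    k = []
  varsFrom (suc n) k = var k ∷ varsFrom n (suc k)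

  idbody : ℕ → ℕ → Fm
  idbody n i = pvar n i (varsFrom n 0)

  liftSι : ℕ → Subst → Subst
  ind (liftSι k σ) = liftι k (ind σ)
  prd (liftSι k σ) n i = subι (liftι n (shiftι k)) (prd σ n i)

  liftSπ : ℕ → Subst → Subst
  ind (liftSπ b σ) = ind σ
  prd (liftSπ b σ) n zero =
    if n ≡ᵇ b then idbody n zero else renπ (shiftπ b) (prd σ n zero)
  prd (liftSπ b σ) n (suc i) =
    if n ≡ᵇ b then renπ (shiftπ b) (prd σ n i) else renπ (shiftπ b) (prd σ n (suc i))

  sub : Subst → Fm → Fm
  sub σ ⊥'            = ⊥'
  sub σ (pvar n i ts) = subι (inst (subTs (ind σ) ts) var) (prd σ n i)
  sub σ (pcon P ts)   = pcon P (subTs (ind σ) ts)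
  sub σ (A ⇒ B)       = sub σ A ⇒ sub σ B
  sub σ (∀ι A)        = ∀ι (sub (liftSι 1 σ) A)
  sub σ (∀π n A)      = ∀π n (sub (liftSπ n σ) A)
  sub σ (μ m D ts)    = μ m (sub (liftSι m (liftSπ m σ)) D) (subTs (ind σ) ts)

  -- replace the m-ary predicate variable 0 by the body G
  -- (other m-ary predicate variables are shifted down, the rest unchanged)
  replC : ℕ → Fm → ℕ → ℕ → Fm
  replC m G n zero    = if n ≡ᵇ m then G else idbody n zero
  replC m G n (suc i) = if n ≡ᵇ m then idbody n i else idbody n (suc i)

  -- D[μ C x̄ D⟨z̄⟩ / C(z̄)][t̄/x̄]  is  sub (σd m D ts) D
  σd : (m : ℕ) → Fm → Vec Term m → Subst
  ind (σd m D ts) = inst ts var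
  prd (σd m D ts) = replC m (μ m (subι (liftι m (shiftι m)) D) (varsFrom m 0))

  -- D[F / C(x1..xm)]  is  sub (σg m F) D  (F has x1..xm as individual vars 0..m-1)
  σg : (m : ℕ) → Fm → Subst
  ind (σg m F) = var
  prd (σg m F) = replC m (subι (liftι m (shiftι m)) F)

  data Kind : Set where
    ι : Kind
    π : ℕ → Kind

  Item : Kind → Set
  Item ι     = Term
  Item (π n) = Fm

  ∀K : Kind → Fm → Fm
  ∀K ι     = ∀ι
  ∀K (π n) = ∀π n

  -- ∀v1 ... ∀vk M   (head of the list = outermost quantifier)
  ∀* : List Kind → Fm → Fm
  ∀* []       M = M
  ∀* (k ∷ ks) M = ∀K k (∀* ks M)

  single : (k : Kind) → Item k → Subst
  ind (single ι t) = inst (t ∷ []) var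
  prd (single ι t) = idbody
  ind (single (π n) G) = var
  prd (single (π n) G) = replC n G

  liftK : Kind → Subst → Subst
  liftK ι     = liftSι 1
  liftK (π n) = liftSπ n

  lift* : List Kind → Subst → Subst
  lift* []       σ = σ
  lift* (k ∷ ks) σ = lift* ks (liftK k σ)

  cntι : List Kind → ℕ
  cntι []          = zero
  cntι (ι ∷ ks)    = suc (cntι ks)
  cntι (π _ ∷ ks)  = cntι ks

  cntπ : ℕ → List Kind → ℕ
  cntπ n []         = zero
  cntπ n (ι ∷ ks)   = cntπ n ks
  cntπ n (π m ∷ ks) = if n ≡ᵇ m then suc (cntπ n ks) else cntπ n ks

  weakS : List Kind → Subst
  ind (weakS vs') j   = var (cntι vs' + j)
  prd (weakS vs') n i = idbody n (cntπ n vs' + i)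

  instSeq : (vs : List Kind) → All Item vs → Fm → Fm
  instSeq []       []       M = M
  instSeq (k ∷ ks) (g ∷ gs) M = instSeq ks gs (sub (lift* ks (single k g)) M)

  -- M[G/v]: M lives under the prefix vs (the variables v); the result, and
  -- the terms/formulas of G, live under the prefix vs' (the variables v').
  substSeq : (vs vs' : List Kind) → All Item vs → Fm → Fm
  substSeq vs vs' G M = instSeq vs G (sub (lift* vs (weakS vs')) M)

  data Occurs (m : ℕ) : ℕ → Fm → Set where
    here : ∀ {k ts} → Occurs m k (pvar m k ts)
    ⇒ˡ   : ∀ {k A B} → Occurs m k A → Occurs m k (A ⇒ B)
    ⇒ʳ   : ∀ {k A B} → Occurs m k B → Occurs m k (A ⇒ B)
    ∀ι   : ∀ {k A} → Occurs m k A → Occurs m k (∀ι A)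
    ∀π   : ∀ {k n A} → Occurs m (shiftπ n m k) A → Occurs m k (∀π n A)
    μ    : ∀ {k n D ts} → Occurs m (shiftπ n m k) D → Occurs m k (μ n D ts)

  mutual
    data Pos (m : ℕ) : ℕ → Fm → Set where
      ⊥'   : ∀ {k} → Pos m k ⊥'
      pvar : ∀ {k n i ts} → Pos m k (pvar n i ts)
      pcon : ∀ {k P ts} → Pos m k (pcon P ts)
      _⇒_  : ∀ {k A B} → Neg m k A → Pos m k B → Pos m k (A ⇒ B)
      ∀ι   : ∀ {k A} → Pos m k A → Pos m k (∀ι A)
      ∀π   : ∀ {k n A} → Pos m (shiftπ n m k) A → Pos m k (∀π n A)
      μ    : ∀ {k n D ts} → Pos m (shiftπ n m k) D → Pos m k (μ n D ts)

    data Neg (m : ℕ) : ℕ → Fm → Set where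
      ⊥'   : ∀ {k} → Neg m k ⊥'
      pvar : ∀ {k n i ts} → ¬ (n ≡ m × i ≡ k) → Neg m k (pvar n i ts)
      pcon : ∀ {k P ts} → Neg m k (pcon P ts)
      _⇒_  : ∀ {k A B} → Pos m k A → Neg m k B → Neg m k (A ⇒ B)
      ∀ι   : ∀ {k A} → Neg m k A → Neg m k (∀ι A)
      ∀π   : ∀ {k n A} → Neg m (shiftπ n m k) A → Neg m k (∀π n A)
      μ    : ∀ {k n D ts} → Neg m (shiftπ n m k) D → Neg m k (μ n D ts)

  data WF : Fm → Set where
    ⊥'   : WF ⊥'
    pvar : ∀ {n i ts} → WF (pvar n i ts)
    pcon : ∀ {P ts} → WF (pcon P ts)
    _⇒_  : ∀ {A B} → WF A → WF B → WF (A ⇒ B)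
    ∀ι   : ∀ {A} → WF A → WF (∀ι A)
    ∀π   : ∀ {n A} → WF A → WF (∀π n A)
    μ    : ∀ {m D ts} → WF D → Occurs m 0 D → Pos m 0 D → WF (μ m D ts)

  WFItem : (k : Kind) → Item k → Set
  WFItem ι     t = ⊤
  WFItem (π n) G = WF G

  WFSeq : (vs : List Kind) → All Item vs → Set
  WFSeq []       []       = ⊤
  WFSeq (k ∷ ks) (g ∷ gs) = WFItem k g × WFSeq ks gs

  data ArrowType : Fm → Set where
    _⇒_ : ∀ A B → ArrowType (A ⇒ B)
    ∀ι  : ∀ {A} → ArrowType A → ArrowType (∀ι A)
    ∀π  : ∀ {n A} → ArrowType A → ArrowType (∀π n A)
    μ   : ∀ {m D ts} → ArrowType D → ArrowType (μ m D ts)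

  -- Rep (only meaningful on arrow types; identity on the other formulas)
  Rep : Fm → Fm
  Rep ⊥'            = ⊥'
  Rep (pvar n i ts) = pvar n i ts
  Rep (pcon P ts)   = pcon P ts
  Rep (A ⇒ B)       = A ⇒ B
  Rep (∀ι A)        = ∀ι (Rep A)
  Rep (∀π n A)      = ∀π n (Rep A)
  Rep (μ m B ts)    = sub (σd m B ts) (Rep B)

  module Inclusion (E : Term → Term → Set) where

    data Particular : Term → Term → Set where
      fwd : ∀ {l r} → E l r → (ρ : ℕ → Term) → Particular (subT ρ l) (subT ρ r)
      bwd : ∀ {l r} → E l r → (ρ : ℕ → Term) → Particular (subT ρ r) (subT ρ l)

    infix 4 _⊆_

    data _⊆_ : Fm → Fm → Set where
      ax    : ∀ {A} → WF A → A ⊆ A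
      arr   : ∀ {A A' B B'} → A ⊆ A' → B ⊆ B' → (A' ⇒ B) ⊆ (A ⇒ B')
      ∀ιl   : ∀ {A B} (t : Term) → sub (single ι t) A ⊆ B → ∀ι A ⊆ B
      ∀πl   : ∀ {n A B} (G : Fm) → sub (single (π n) G) A ⊆ B → ∀π n A ⊆ B
      ∀ιr   : ∀ {A B} → subι (shiftι 1) A ⊆ B → A ⊆ ∀ι B
      ∀πr   : ∀ {n A B} → renπ (shiftπ n) A ⊆ B → A ⊆ ∀π n B
      eqn   : ∀ {A B u w} → Particular u w →
              A ⊆ sub (single ι u) B → A ⊆ sub (single ι w) B
      trans : ∀ {A B C} → A ⊆ B → B ⊆ C → A ⊆ C
      μd    : ∀ {m D ts} → WF (μ m D ts) → sub (σd m D ts) D ⊆ μ m D ts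
      μg'   : ∀ {m D ts} → WF (μ m D ts) → μ m D ts ⊆ sub (σd m D ts) D
      μg    : ∀ {m D ts F} → WF (μ m D ts) →
              sub (σg m F) D ⊆ F → μ m D ts ⊆ subι (inst ts var) F

module Submission where

-- The proof is an induction on the derivation of A ⊆ B (repIncl, at the end),
-- with the invariant A ≼ B: "the conclusion holds for the presentations of
-- Rep A and Rep B", where the instantiation [G⃗/v⃗] is a single simultaneous
-- substitution.  Every rule of ⊆ is matched by a closure property of this
-- invariant: reflexivity, transitivity, instantiating a quantifier on the
-- left, generalising on the right, stability under substitution and under the
-- equations of E, and, for the induction rule μ_g, monotonicity of
-- substitution in a positive predicate variable.

open import Defs
open import Data.Nat using (ℕ; zero; suc; _+_; _≡ᵇ_; _<_; z<s; s<s)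
open import Data.Nat.Properties using (_≟_; suc-injective; 0≢1+n; +-suc; +-identityʳ; m<m+n)
open import Data.Bool using (true; false; if_then_else_)
open import Data.Vec using (Vec; []; _∷_)
open import Data.List using (List; []; _∷_)
open import Data.List.Relation.Unary.All using (All; []; _∷_)
open import Data.Product using (Σ; _×_; _,_; proj₁; proj₂)
open import Data.Sum using (_⊎_; inj₁; inj₂)
open import Data.Unit using (tt)
open import Data.Empty using (⊥; ⊥-elim)
open import Relation.Nullary using (¬_; Dec; yes; no)
open import Relation.Binary.PropositionalEquality

module Substitution (S : Signature) where
  open Syntax S

  infix 4 _≐_
  _≐_ : (ℕ → Term) → (ℕ → Term) → Set
  ρ ≐ ρ' = ∀ j → ρ j ≡ ρ' j

  _⊚_ : (ℕ → Term) → (ℕ → Term) → ℕ → Term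
  (ρ ⊚ ρ') j = subT ρ (ρ' j)

  mutual
    subT-ext : ∀ {ρ ρ'} → ρ ≐ ρ' → ∀ t → subT ρ t ≡ subT ρ' t
    subT-ext e (var x) = e x
    subT-ext e (fn f ts) = cong (fn f) (subTs-ext e ts)

    subTs-ext : ∀ {n ρ ρ'} → ρ ≐ ρ' → (ts : Vec Term n) → subTs ρ ts ≡ subTs ρ' ts
    subTs-ext e [] = refl
    subTs-ext e (t ∷ ts) = cong₂ _∷_ (subT-ext e t) (subTs-ext e ts)

  mutual
    subT-id : ∀ t → subT var t ≡ t
    subT-id (var x) = refl
    subT-id (fn f ts) = cong (fn f) (subTs-id ts)

    subTs-id : ∀ {n} (ts : Vec Term n) → subTs var ts ≡ ts
    subTs-id [] = refl
    subTs-id (t ∷ ts) = cong₂ _∷_ (subT-id t) (subTs-id ts)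

  mutual
    subT-comp : ∀ ρ ρ' t → subT ρ (subT ρ' t) ≡ subT (ρ ⊚ ρ') t
    subT-comp ρ ρ' (var x) = refl
    subT-comp ρ ρ' (fn f ts) = cong (fn f) (subTs-comp ρ ρ' ts)

    subTs-comp : ∀ {n} ρ ρ' (ts : Vec Term n) → subTs ρ (subTs ρ' ts) ≡ subTs (ρ ⊚ ρ') ts
    subTs-comp ρ ρ' [] = refl
    subTs-comp ρ ρ' (t ∷ ts) = cong₂ _∷_ (subT-comp ρ ρ' t) (subTs-comp ρ ρ' ts)

  liftι-ext : ∀ k {ρ ρ'} → ρ ≐ ρ' → liftι k ρ ≐ liftι k ρ'
  liftι-ext zero e j = e j
  liftι-ext (suc k) e zero = refl
  liftι-ext (suc k) e (suc j) = cong wk1 (liftι-ext k e j)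

  liftι-id : ∀ k → liftι k var ≐ var
  liftι-id zero j = refl
  liftι-id (suc k) zero = refl
  liftι-id (suc k) (suc j) = cong wk1 (liftι-id k j)

  wk1-sub : ∀ σ t → subT σ (wk1 t) ≡ subT (λ x → σ (suc x)) t
  wk1-sub σ t = subT-comp σ (λ x → var (suc x)) t

  sub-wk1 : ∀ ρ t → wk1 (subT ρ t) ≡ subT (λ x → wk1 (ρ x)) t
  sub-wk1 ρ t = subT-comp (λ x → var (suc x)) ρ t

  liftι-comp : ∀ k ρ ρ' → (liftι k ρ ⊚ liftι k ρ') ≐ liftι k (ρ ⊚ ρ')
  liftι-comp zero ρ ρ' j = refl
  liftι-comp (suc k) ρ ρ' zero = refl
  liftι-comp (suc k) ρ ρ' (suc j) =
    trans (wk1-sub (liftι (suc k) ρ) (liftι k ρ' j))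
    (trans (sym (sub-wk1 (liftι k ρ) (liftι k ρ' j))) (cong wk1 (liftι-comp k ρ ρ' j)))

  liftι-hi : ∀ k ρ j → liftι k ρ (k + j) ≡ subT (shiftι k) (ρ j)
  liftι-hi zero ρ j = sym (subT-id (ρ j))
  liftι-hi (suc k) ρ j = trans (cong wk1 (liftι-hi k ρ j)) (subT-comp (λ x → var (suc x)) (shiftι k) (ρ j))

  liftι-lo : ∀ k ρ j → j < k → liftι k ρ j ≡ var j
  liftι-lo (suc k) ρ zero _ = refl
  liftι-lo (suc k) ρ (suc j) (s<s p) = cong wk1 (liftι-lo k ρ j p)

  inst-hi : ∀ {n} (us : Vec Term n) ρ j → inst us ρ (n + j) ≡ ρ j
  inst-hi [] ρ j = refl
  inst-hi (u ∷ us) ρ j = inst-hi us ρ j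

  data Split (k : ℕ) : ℕ → Set where
    lo : ∀ {j} → j < k → Split k j
    hi : ∀ j → Split k (k + j)

  split : ∀ k j → Split k j
  split zero j = hi j
  split (suc k) zero = lo z<s
  split (suc k) (suc j) with split k j
  ... | lo p = lo (s<s p)
  ... | hi j' = hi j'

  split≐ : ∀ k {f g : ℕ → Term} → (∀ j → j < k → f j ≡ g j) → (∀ j → f (k + j) ≡ g (k + j)) → f ≐ g
  split≐ k l h j with split k j
  ... | lo p = l _ p
  ... | hi j' = h j'

  varsFrom-suc : ∀ n k ρ → subTs ρ (varsFrom n (suc k)) ≡ subTs (λ x → ρ (suc x)) (varsFrom n k)
  varsFrom-suc zero k ρ = refl
  varsFrom-suc (suc n) k ρ = cong (ρ (suc k) ∷_) (varsFrom-suc n (suc k) ρ)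

  inst-vars : ∀ {n} (us : Vec Term n) ρ → subTs (inst us ρ) (varsFrom n 0) ≡ us
  inst-vars [] ρ = refl
  inst-vars (u ∷ us) ρ = cong (u ∷_) (trans (varsFrom-suc _ 0 (inst (u ∷ us) ρ)) (inst-vars us ρ))

  varsFrom-fixed : ∀ ρ n k → (∀ j → j < k + n → ρ j ≡ var j) → subTs ρ (varsFrom n k) ≡ varsFrom n k
  varsFrom-fixed ρ zero k h = refl
  varsFrom-fixed ρ (suc n) k h =
    cong₂ _∷_ (h k (m<m+n k z<s)) (varsFrom-fixed ρ n (suc k) (λ j p → h j (subst (j <_) (sym (+-suc k n)) p)))

  liftι-vars : ∀ n ρ → subTs (liftι n ρ) (varsFrom n 0) ≡ varsFrom n 0
  liftι-vars n ρ = varsFrom-fixed (liftι n ρ) n 0 (liftι-lo n ρ)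

  ≡ᵇ-refl : ∀ n → (n ≡ᵇ n) ≡ true
  ≡ᵇ-refl zero = refl
  ≡ᵇ-refl (suc n) = ≡ᵇ-refl n

  ≡ᵇ-sound : ∀ n m → (n ≡ᵇ m) ≡ true → n ≡ m
  ≡ᵇ-sound zero zero e = refl
  ≡ᵇ-sound (suc n) (suc m) e = cong suc (≡ᵇ-sound n m e)
  ≡ᵇ-sound zero (suc m) ()
  ≡ᵇ-sound (suc n) zero ()

  Ren : Set
  Ren = ℕ → ℕ → ℕ

  infix 4 _≗π_
  _≗π_ : Ren → Ren → Set
  r ≗π r' = ∀ n i → r n i ≡ r' n i

  _∘π_ : Ren → Ren → Ren
  (r ∘π r') n i = r n (r' n i)

  liftπ-other : ∀ b r n i → (n ≡ᵇ b) ≡ false → liftπ b r n i ≡ r n i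
  liftπ-other b r n zero e rewrite e = refl
  liftπ-other b r n (suc i) e rewrite e = refl

  liftπ-bound-zero : ∀ b r n → (n ≡ᵇ b) ≡ true → liftπ b r n 0 ≡ 0
  liftπ-bound-zero b r n e rewrite e = refl

  liftπ-bound-suc : ∀ b r n i → (n ≡ᵇ b) ≡ true → liftπ b r n (suc i) ≡ suc (r n i)
  liftπ-bound-suc b r n i e rewrite e = refl

  shiftπ-bound : ∀ b n i → (n ≡ᵇ b) ≡ true → shiftπ b n i ≡ suc i
  shiftπ-bound b n i e rewrite e = refl

  liftπ-ext : ∀ b {r r'} → r ≗π r' → liftπ b r ≗π liftπ b r'
  liftπ-ext b e n zero with n ≡ᵇ b
  ... | true = refl
  ... | false = e n 0
  liftπ-ext b e n (suc i) with n ≡ᵇ b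
  ... | true = cong suc (e n i)
  ... | false = e n (suc i)

  liftπ-comp : ∀ b r r' → (liftπ b r ∘π liftπ b r') ≗π liftπ b (r ∘π r')
  liftπ-comp b r r' n zero with n ≡ᵇ b in eq
  ... | true rewrite eq = refl
  ... | false = liftπ-other b r n (r' n 0) eq
  liftπ-comp b r r' n (suc i) with n ≡ᵇ b in eq
  ... | true rewrite eq = refl
  ... | false = liftπ-other b r n (r' n (suc i)) eq

  liftπ-shift : ∀ b r → (liftπ b r ∘π shiftπ b) ≗π (shiftπ b ∘π r)
  liftπ-shift b r n i with n ≡ᵇ b in eq
  ... | true rewrite eq = refl
  ... | false = liftπ-other b r n i eq

  subι-ext : ∀ {ρ ρ'} → ρ ≐ ρ' → ∀ A → subι ρ A ≡ subι ρ' A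
  subι-ext e ⊥' = refl
  subι-ext e (pvar n i ts) = cong (pvar n i) (subTs-ext e ts)
  subι-ext e (pcon P ts) = cong (pcon P) (subTs-ext e ts)
  subι-ext e (A ⇒ B) = cong₂ _⇒_ (subι-ext e A) (subι-ext e B)
  subι-ext e (∀ι A) = cong ∀ι (subι-ext (liftι-ext 1 e) A)
  subι-ext e (∀π n A) = cong (∀π n) (subι-ext e A)
  subι-ext e (μ m D ts) = cong₂ (μ m) (subι-ext (liftι-ext m e) D) (subTs-ext e ts)

  subι-id : ∀ A → subι var A ≡ A
  subι-id ⊥' = refl
  subι-id (pvar n i ts) = cong (pvar n i) (subTs-id ts)
  subι-id (pcon P ts) = cong (pcon P) (subTs-id ts)
  subι-id (A ⇒ B) = cong₂ _⇒_ (subι-id A) (subι-id B)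
  subι-id (∀ι A) = cong ∀ι (trans (subι-ext (liftι-id 1) A) (subι-id A))
  subι-id (∀π n A) = cong (∀π n) (subι-id A)
  subι-id (μ m D ts) = cong₂ (μ m) (trans (subι-ext (liftι-id m) D) (subι-id D)) (subTs-id ts)

  subι-comp : ∀ ρ ρ' A → subι ρ (subι ρ' A) ≡ subι (ρ ⊚ ρ') A
  subι-comp ρ ρ' ⊥' = refl
  subι-comp ρ ρ' (pvar n i ts) = cong (pvar n i) (subTs-comp ρ ρ' ts)
  subι-comp ρ ρ' (pcon P ts) = cong (pcon P) (subTs-comp ρ ρ' ts)
  subι-comp ρ ρ' (A ⇒ B) = cong₂ _⇒_ (subι-comp ρ ρ' A) (subι-comp ρ ρ' B)
  subι-comp ρ ρ' (∀ι A) = cong ∀ι (trans (subι-comp _ _ A) (subι-ext (liftι-comp 1 ρ ρ') A))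
  subι-comp ρ ρ' (∀π n A) = cong (∀π n) (subι-comp ρ ρ' A)
  subι-comp ρ ρ' (μ m D ts) = cong₂ (μ m) (trans (subι-comp _ _ D) (subι-ext (liftι-comp m ρ ρ') D)) (subTs-comp ρ ρ' ts)

  renπ-ext : ∀ {r r'} → r ≗π r' → ∀ A → renπ r A ≡ renπ r' A
  renπ-ext e ⊥' = refl
  renπ-ext e (pvar n i ts) = cong (λ k → pvar n k ts) (e n i)
  renπ-ext e (pcon P ts) = refl
  renπ-ext e (A ⇒ B) = cong₂ _⇒_ (renπ-ext e A) (renπ-ext e B)
  renπ-ext e (∀ι A) = cong ∀ι (renπ-ext e A)
  renπ-ext e (∀π n A) = cong (∀π n) (renπ-ext (liftπ-ext n e) A)
  renπ-ext e (μ m D ts) = cong (λ X → μ m X ts) (renπ-ext (liftπ-ext m e) D)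

  renπ-comp : ∀ r r' A → renπ r (renπ r' A) ≡ renπ (r ∘π r') A
  renπ-comp r r' ⊥' = refl
  renπ-comp r r' (pvar n i ts) = refl
  renπ-comp r r' (pcon P ts) = refl
  renπ-comp r r' (A ⇒ B) = cong₂ _⇒_ (renπ-comp r r' A) (renπ-comp r r' B)
  renπ-comp r r' (∀ι A) = cong ∀ι (renπ-comp r r' A)
  renπ-comp r r' (∀π n A) = cong (∀π n) (trans (renπ-comp _ _ A) (renπ-ext (liftπ-comp n r r') A))
  renπ-comp r r' (μ m D ts) = cong (λ X → μ m X ts) (trans (renπ-comp _ _ D) (renπ-ext (liftπ-comp m r r') D))

  renπ-subι : ∀ r ρ A → renπ r (subι ρ A) ≡ subι ρ (renπ r A)
  renπ-subι r ρ ⊥' = refl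
  renπ-subι r ρ (pvar n i ts) = refl
  renπ-subι r ρ (pcon P ts) = refl
  renπ-subι r ρ (A ⇒ B) = cong₂ _⇒_ (renπ-subι r ρ A) (renπ-subι r ρ B)
  renπ-subι r ρ (∀ι A) = cong ∀ι (renπ-subι r _ A)
  renπ-subι r ρ (∀π n A) = cong (∀π n) (renπ-subι _ ρ A)
  renπ-subι r ρ (μ m D ts) = cong (λ X → μ m X (subTs ρ ts)) (renπ-subι _ _ D)

  -- Pointwise equality of simultaneous substitutions (function extensionality is not available).
  infix 4 _≈S_
  record _≈S_ (σ τ : Subst) : Set where
    constructor mk≈
    field
      ≈i : ind σ ≐ ind τ
      ≈p : ∀ n i → prd σ n i ≡ prd τ n i
  open _≈S_ public

  ≈refl : ∀ {σ} → σ ≈S σ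
  ≈refl = mk≈ (λ _ → refl) (λ _ _ → refl)

  ≈sym : ∀ {σ τ} → σ ≈S τ → τ ≈S σ
  ≈sym (mk≈ a b) = mk≈ (λ j → sym (a j)) (λ n i → sym (b n i))

  ≈trans : ∀ {σ τ υ} → σ ≈S τ → τ ≈S υ → σ ≈S υ
  ≈trans (mk≈ a b) (mk≈ c d) = mk≈ (λ j → trans (a j) (c j)) (λ n i → trans (b n i) (d n i))

  liftSπ-other : ∀ b σ n j → (n ≡ᵇ b) ≡ false → prd (liftSπ b σ) n j ≡ renπ (shiftπ b) (prd σ n j)
  liftSπ-other b σ n zero q rewrite q = refl
  liftSπ-other b σ n (suc j) q rewrite q = refl

  liftSπ-bound-zero : ∀ b σ n → (n ≡ᵇ b) ≡ true → prd (liftSπ b σ) n 0 ≡ idbody n 0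
  liftSπ-bound-zero b σ n q rewrite q = refl

  liftSπ-shifted : ∀ b σ n j → prd (liftSπ b σ) n (shiftπ b n j) ≡ renπ (shiftπ b) (prd σ n j)
  liftSπ-shifted b σ n j with n ≡ᵇ b in eq
  ... | true rewrite eq = refl
  ... | false = liftSπ-other b σ n j eq

  liftSι-ext : ∀ k {σ τ} → σ ≈S τ → liftSι k σ ≈S liftSι k τ
  liftSι-ext k (mk≈ a b) = mk≈ (liftι-ext k a) (λ n i → cong (subι _) (b n i))

  liftSπ-prd-ext : ∀ b {σ τ} → (∀ n i → prd σ n i ≡ prd τ n i) → ∀ n i → prd (liftSπ b σ) n i ≡ prd (liftSπ b τ) n i
  liftSπ-prd-ext b p n zero = cong (if n ≡ᵇ b then idbody n zero else_) (cong (renπ (shiftπ b)) (p n 0))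
  liftSπ-prd-ext b p n (suc i) = cong₂ (if n ≡ᵇ b then_else_) (cong (renπ (shiftπ b)) (p n i))
      (cong (renπ (shiftπ b)) (p n (suc i)))

  liftSπ-ext : ∀ b {σ τ} → σ ≈S τ → liftSπ b σ ≈S liftSπ b τ
  liftSπ-ext b (mk≈ a p) = mk≈ a (liftSπ-prd-ext b p)

  sub-ext : ∀ {σ τ} → σ ≈S τ → ∀ A → sub σ A ≡ sub τ A
  sub-ext e ⊥' = refl
  sub-ext {σ} {τ} e (pvar n i ts) = cong₂ (λ X Y → subι (inst X var) Y) (subTs-ext (≈i e) ts) (≈p e n i)
  sub-ext e (pcon P ts) = cong (pcon P) (subTs-ext (≈i e) ts)
  sub-ext e (A ⇒ B) = cong₂ _⇒_ (sub-ext e A) (sub-ext e B)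
  sub-ext e (∀ι A) = cong ∀ι (sub-ext (liftSι-ext 1 e) A)
  sub-ext e (∀π n A) = cong (∀π n) (sub-ext (liftSπ-ext n e) A)
  sub-ext e (μ m D ts) = cong₂ (μ m) (sub-ext (liftSι-ext m (liftSπ-ext m e)) D) (subTs-ext (≈i e) ts)

  _⊙ι_ : Subst → (ℕ → Term) → Subst
  ind (σ ⊙ι ρ) = ind σ ⊚ ρ
  prd (σ ⊙ι ρ) = prd σ

  sub-subι : ∀ σ ρ A → sub σ (subι ρ A) ≡ sub (σ ⊙ι ρ) A
  sub-subι σ ρ ⊥' = refl
  sub-subι σ ρ (pvar n i ts) = cong (λ X → subι (inst X var) (prd σ n i)) (subTs-comp (ind σ) ρ ts)
  sub-subι σ ρ (pcon P ts) = cong (pcon P) (subTs-comp (ind σ) ρ ts)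
  sub-subι σ ρ (A ⇒ B) = cong₂ _⇒_ (sub-subι σ ρ A) (sub-subι σ ρ B)
  sub-subι σ ρ (∀ι A) = cong ∀ι (trans (sub-subι _ _ A) (sub-ext (mk≈ (liftι-comp 1 (ind σ) ρ) (λ _ _ → refl)) A))
  sub-subι σ ρ (∀π n A) = cong (∀π n) (trans (sub-subι (liftSπ n σ) ρ A)
      (sub-ext (mk≈ (λ _ → refl) (liftSπ-prd-ext n (λ _ _ → refl))) A))
  sub-subι σ ρ (μ m D ts) = cong₂ (μ m) (trans (sub-subι _ _ D)
      (sub-ext (mk≈ (liftι-comp m (ind σ) ρ) (λ n i → cong (subι _) (liftSπ-prd-ext m (λ _ _ → refl) n i))) D))
    (subTs-comp (ind σ) ρ ts)

  _⊙π_ : Subst → Ren → Subst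
  ind (σ ⊙π r) = ind σ
  prd (σ ⊙π r) n i = prd σ n (r n i)

  liftSπ-⊙π : ∀ b σ r → (liftSπ b σ ⊙π liftπ b r) ≈S liftSπ b (σ ⊙π r)
  liftSπ-⊙π b σ r = mk≈ (λ _ → refl) bodies
    where
    bodies : ∀ n i → prd (liftSπ b σ) n (liftπ b r n i) ≡ prd (liftSπ b (σ ⊙π r)) n i
    bodies n zero with n ≡ᵇ b in eq
    ... | true rewrite eq = refl
    ... | false = liftSπ-other b σ n (r n 0) eq
    bodies n (suc i) with n ≡ᵇ b in eq
    ... | true rewrite eq = refl
    ... | false = liftSπ-other b σ n (r n (suc i)) eq

  sub-renπ : ∀ σ r A → sub σ (renπ r A) ≡ sub (σ ⊙π r) A
  sub-renπ σ r ⊥' = refl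
  sub-renπ σ r (pvar n i ts) = refl
  sub-renπ σ r (pcon P ts) = refl
  sub-renπ σ r (A ⇒ B) = cong₂ _⇒_ (sub-renπ σ r A) (sub-renπ σ r B)
  sub-renπ σ r (∀ι A) = cong ∀ι (trans (sub-renπ (liftSι 1 σ) r A) (sub-ext (mk≈ (λ _ → refl) (λ _ _ → refl)) A))
  sub-renπ σ r (∀π n A) = cong (∀π n) (trans (sub-renπ _ _ A) (sub-ext (liftSπ-⊙π n σ r) A))
  sub-renπ σ r (μ m D ts) = cong (λ X → μ m X (subTs (ind σ) ts))
    (trans (sub-renπ _ _ D) (sub-ext (liftSι-ext m (liftSπ-⊙π m σ r)) D))

  liftSπ-nat : ∀ b σ σ' (Φ Ψ : ℕ → Fm → Fm) →
    (∀ n i → prd σ' n i ≡ Ψ n (prd σ n i)) →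
    (∀ n → (n ≡ᵇ b) ≡ true → Φ n (idbody n 0) ≡ idbody n 0) →
    (∀ n B → Φ n (renπ (shiftπ b) B) ≡ renπ (shiftπ b) (Ψ n B)) →
    ∀ n i → Φ n (prd (liftSπ b σ) n i) ≡ prd (liftSπ b σ') n i
  liftSπ-nat b σ σ' Φ Ψ e h0 hs n zero with n ≡ᵇ b in eq
  ... | true = h0 n eq
  ... | false = trans (hs n _) (cong (renπ (shiftπ b)) (sym (e n 0)))
  liftSπ-nat b σ σ' Φ Ψ e h0 hs n (suc i) with n ≡ᵇ b
  ... | true = trans (hs n _) (cong (renπ (shiftπ b)) (sym (e n i)))
  ... | false = trans (hs n _) (cong (renπ (shiftπ b)) (sym (e n (suc i))))

  _ι⊙_ : (ℕ → Term) → Subst → Subst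
  ind (ρ ι⊙ σ) = ρ ⊚ ind σ
  prd (ρ ι⊙ σ) n i = subι (liftι n ρ) (prd σ n i)

  inst-lo : ∀ {n} (us : Vec Term n) ρ j → j < n → inst (subTs ρ us) var j ≡ subT ρ (inst us var j)
  inst-lo (u ∷ us) ρ zero p = refl
  inst-lo (u ∷ us) ρ (suc j) (s<s p) = inst-lo us ρ j p

  inst-lift : ∀ {n} (us : Vec Term n) ρ → (ρ ⊚ inst us var) ≐ (inst (subTs ρ us) var ⊚ liftι n ρ)
  inst-lift {n} us ρ = split≐ n
    (λ j p → trans (sym (inst-lo us ρ j p)) (cong (subT (inst (subTs ρ us) var)) (sym (liftι-lo n ρ j p))))
    (λ j → trans (cong (subT ρ) (inst-hi us var j))
      (sym (trans (cong (subT (inst (subTs ρ us) var)) (liftι-hi n ρ j))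
        (trans (subT-comp _ _ (ρ j)) (trans (subT-ext (inst-hi (subTs ρ us) var) (ρ j)) (subT-id (ρ j)))))))

  idbody-lift : ∀ n ρ i → subι (liftι n ρ) (idbody n i) ≡ idbody n i
  idbody-lift n ρ i = cong (pvar n i) (liftι-vars n ρ)

  liftι-liftSι : ∀ k ρ σ → (liftι k ρ ι⊙ liftSι k σ) ≈S liftSι k (ρ ι⊙ σ)
  liftι-liftSι k ρ σ = mk≈ (liftι-comp k ρ (ind σ)) (λ n i →
    trans (subι-comp _ _ (prd σ n i)) (trans (subι-ext (λ j →
      trans (liftι-comp n (liftι k ρ) (shiftι k) j) (trans (liftι-ext n (liftι-hi k ρ) j)
          (sym (liftι-comp n (shiftι k) ρ j))))
      (prd σ n i)) (sym (subι-comp _ _ (prd σ n i)))))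

  ι⊙-liftSπ : ∀ b ρ σ → (ρ ι⊙ liftSπ b σ) ≈S liftSπ b (ρ ι⊙ σ)
  ι⊙-liftSπ b ρ σ = mk≈ (λ _ → refl) (liftSπ-nat b σ (ρ ι⊙ σ) (λ n → subι (liftι n ρ)) (λ n → subι (liftι n ρ))
    (λ _ _ → refl) (λ n _ → idbody-lift n ρ 0) (λ n B → sym (renπ-subι (shiftπ b) (liftι n ρ) B)))

  subι-sub : ∀ ρ σ A → subι ρ (sub σ A) ≡ sub (ρ ι⊙ σ) A
  subι-sub ρ σ ⊥' = refl
  subι-sub ρ σ (pvar n i ts) =
    trans (subι-comp ρ _ (prd σ n i)) (trans (subι-ext (inst-lift (subTs (ind σ) ts) ρ) (prd σ n i))
      (trans (sym (subι-comp _ _ (prd σ n i)))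
          (cong (λ X → subι (inst X var) (subι (liftι n ρ) (prd σ n i))) (subTs-comp ρ (ind σ) ts))))
  subι-sub ρ σ (pcon P ts) = cong (pcon P) (subTs-comp ρ (ind σ) ts)
  subι-sub ρ σ (A ⇒ B) = cong₂ _⇒_ (subι-sub ρ σ A) (subι-sub ρ σ B)
  subι-sub ρ σ (∀ι A) = cong ∀ι (trans (subι-sub _ _ A) (sub-ext (liftι-liftSι 1 ρ σ) A))
  subι-sub ρ σ (∀π n A) = cong (∀π n) (trans (subι-sub _ _ A) (sub-ext (ι⊙-liftSπ n ρ σ) A))
  subι-sub ρ σ (μ m D ts) = cong₂ (μ m) (trans (subι-sub _ _ D)
      (sub-ext (≈trans (liftι-liftSι m ρ _) (liftSι-ext m (ι⊙-liftSπ m ρ σ))) D))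
    (subTs-comp ρ (ind σ) ts)

  _π⊙_ : Ren → Subst → Subst
  ind (r π⊙ σ) = ind σ
  prd (r π⊙ σ) n i = renπ r (prd σ n i)

  π⊙-liftSι : ∀ k r σ → (r π⊙ liftSι k σ) ≈S liftSι k (r π⊙ σ)
  π⊙-liftSι k r σ = mk≈ (λ _ → refl) (λ n i → renπ-subι r _ (prd σ n i))

  liftπ-liftSπ : ∀ b r σ → (liftπ b r π⊙ liftSπ b σ) ≈S liftSπ b (r π⊙ σ)
  liftπ-liftSπ b r σ = mk≈ (λ _ → refl) (liftSπ-nat b σ (r π⊙ σ) (λ n → renπ (liftπ b r)) (λ n → renπ r)
    (λ _ _ → refl) (λ n q → cong (λ k → pvar n k (varsFrom n 0)) (liftπ-bound-zero b r n q))
    (λ n B → trans (renπ-comp _ _ B) (trans (renπ-ext (liftπ-shift b r) B) (sym (renπ-comp _ _ B)))))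

  renπ-sub : ∀ r σ A → renπ r (sub σ A) ≡ sub (r π⊙ σ) A
  renπ-sub r σ ⊥' = refl
  renπ-sub r σ (pvar n i ts) = renπ-subι r _ (prd σ n i)
  renπ-sub r σ (pcon P ts) = refl
  renπ-sub r σ (A ⇒ B) = cong₂ _⇒_ (renπ-sub r σ A) (renπ-sub r σ B)
  renπ-sub r σ (∀ι A) = cong ∀ι (trans (renπ-sub _ _ A) (sub-ext (π⊙-liftSι 1 r σ) A))
  renπ-sub r σ (∀π n A) = cong (∀π n) (trans (renπ-sub _ _ A) (sub-ext (liftπ-liftSπ n r σ) A))
  renπ-sub r σ (μ m D ts) = cong (λ X → μ m X (subTs (ind σ) ts))
    (trans (renπ-sub _ _ D) (sub-ext (≈trans (π⊙-liftSι m _ _) (liftSι-ext m (liftπ-liftSπ m r σ))) D))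

  -- Composition of simultaneous substitutions: (σ ⊙ τ) applies τ, then σ.
  infixl 5 _⊙_
  _⊙_ : Subst → Subst → Subst
  ind (σ ⊙ τ) = ind σ ⊚ ind τ
  prd (σ ⊙ τ) n i = sub (liftSι n σ) (prd τ n i)

  unshift : ∀ {n} (us : Vec Term n) m B → subι (liftι m (inst us var)) (subι (liftι m (shiftι n)) B) ≡ B
  unshift {n} us m B = trans (subι-comp _ _ B) (trans (subι-ext (λ j →
    trans (liftι-comp m _ _ j) (trans (liftι-ext m (inst-hi us var) j) (liftι-id m j))) B) (subι-id B))

  liftι-shift-comm : ∀ n k ρ → (liftι n (liftι k ρ) ⊚ liftι n (shiftι k)) ≐ (liftι n (shiftι k) ⊚ liftι n ρ)
  liftι-shift-comm n k ρ j = trans (liftι-comp n (liftι k ρ) (shiftι k) j)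
      (trans (liftι-ext n (liftι-hi k ρ) j) (sym (liftι-comp n (shiftι k) ρ j)))

  liftSι-⊙ : ∀ k σ τ → (liftSι k σ ⊙ liftSι k τ) ≈S liftSι k (σ ⊙ τ)
  liftSι-⊙ k σ τ = mk≈ (liftι-comp k (ind σ) (ind τ)) (λ n i →
    trans (sub-subι _ _ (prd τ n i)) (trans (sub-ext (mk≈ (liftι-shift-comm n k (ind σ)) (λ m j →
      trans (subι-comp _ _ (prd σ m j)) (trans (subι-ext (λ x →
        trans (liftι-comp m _ _ x) (trans (liftι-ext m (λ y → sym (liftι-hi n (shiftι k) y)) x) (sym (liftι-comp m _ _ x))))
        (prd σ m j)) (sym (subι-comp _ _ (prd σ m j)))))) (prd τ n i)) (sym (subι-sub _ _ (prd τ n i)))))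

  idbody-sub : ∀ n σ → prd σ n 0 ≡ idbody n 0 → sub (liftSι n σ) (idbody n 0) ≡ idbody n 0
  idbody-sub n σ e = trans (cong (subι _) (trans (cong (subι (liftι n (shiftι n))) e) (idbody-lift n _ 0)))
    (cong (pvar n 0) (trans (inst-vars _ var) (liftι-vars n (ind σ))))

  liftSπ-⊙ : ∀ b σ τ → (liftSπ b σ ⊙ liftSπ b τ) ≈S liftSπ b (σ ⊙ τ)
  liftSπ-⊙ b σ τ = mk≈ (λ _ → refl) (liftSπ-nat b τ (σ ⊙ τ) (λ n → sub (liftSι n (liftSπ b σ))) (λ n → sub (liftSι n σ))
    (λ _ _ → refl) (λ n q → idbody-sub n (liftSπ b σ) (liftSπ-bound-zero b σ n q))
    (λ n B → trans (sub-renπ _ _ B) (trans (sub-ext (mk≈ (λ _ → refl) (λ m j →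
       trans (cong (subι _) (liftSπ-shifted b σ m j)) (sym (renπ-subι _ _ (prd σ m j))))) B) (sym (renπ-sub _ _ B)))))

  sub-comp : ∀ σ τ A → sub σ (sub τ A) ≡ sub (σ ⊙ τ) A
  sub-comp σ τ ⊥' = refl
  sub-comp σ τ (pvar n i ts) =
    trans (sub-subι σ _ (prd τ n i)) (trans (sub-ext (mk≈ (inst-lift (subTs (ind τ) ts) (ind σ))
      (λ m j → sym (unshift (subTs (ind σ) (subTs (ind τ) ts)) m (prd σ m j)))) (prd τ n i))
      (trans (sym (subι-sub _ _ (prd τ n i)))
          (cong (λ X → subι (inst X var) (sub (liftSι n σ) (prd τ n i))) (subTs-comp (ind σ) (ind τ) ts))))
  sub-comp σ τ (pcon P ts) = cong (pcon P) (subTs-comp (ind σ) (ind τ) ts)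
  sub-comp σ τ (A ⇒ B) = cong₂ _⇒_ (sub-comp σ τ A) (sub-comp σ τ B)
  sub-comp σ τ (∀ι A) = cong ∀ι (trans (sub-comp _ _ A) (sub-ext (liftSι-⊙ 1 σ τ) A))
  sub-comp σ τ (∀π n A) = cong (∀π n) (trans (sub-comp _ _ A) (sub-ext (liftSπ-⊙ n σ τ) A))
  sub-comp σ τ (μ m D ts) = cong₂ (μ m) (trans (sub-comp _ _ D)
      (sub-ext (≈trans (liftSι-⊙ m (liftSπ m σ) (liftSπ m τ)) (liftSι-ext m (liftSπ-⊙ m σ τ))) D))
    (subTs-comp (ind σ) (ind τ) ts)

  idS : Subst
  ind idS = var
  prd idS = idbody

  liftSι-id : ∀ k → liftSι k idS ≈S idS
  liftSι-id k = mk≈ (liftι-id k) (λ n i → idbody-lift n (shiftι k) i)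

  liftSπ-id : ∀ b → liftSπ b idS ≈S idS
  liftSπ-id b = mk≈ (λ _ → refl) bodies
    where
    bodies : ∀ n i → prd (liftSπ b idS) n i ≡ idbody n i
    bodies n zero with n ≡ᵇ b
    ... | true = refl
    ... | false = refl
    bodies n (suc i) with n ≡ᵇ b
    ... | true = refl
    ... | false = refl

  sub-id : ∀ A → sub idS A ≡ A
  sub-id ⊥' = refl
  sub-id (pvar n i ts) = cong (pvar n i) (trans (inst-vars _ var) (subTs-id ts))
  sub-id (pcon P ts) = cong (pcon P) (subTs-id ts)
  sub-id (A ⇒ B) = cong₂ _⇒_ (sub-id A) (sub-id B)
  sub-id (∀ι A) = cong ∀ι (trans (sub-ext (liftSι-id 1) A) (sub-id A))
  sub-id (∀π n A) = cong (∀π n) (trans (sub-ext (liftSπ-id n) A) (sub-id A))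
  sub-id (μ m D ts) = cong₂ (μ m) (trans (sub-ext (≈trans (liftSι-ext m (liftSπ-id m)) (liftSι-id m)) D)
      (sub-id D)) (subTs-id ts)

  ιS : (ℕ → Term) → Subst
  ind (ιS ρ) = ρ
  prd (ιS ρ) = idbody

  πS : Ren → Subst
  ind (πS r) = var
  prd (πS r) n i = idbody n (r n i)

  subι-as-sub : ∀ ρ A → subι ρ A ≡ sub (ιS ρ) A
  subι-as-sub ρ A = trans (sym (sub-id (subι ρ A))) (trans (sub-subι idS ρ A)
      (sub-ext (mk≈ (λ j → subT-id (ρ j)) (λ _ _ → refl)) A))

  renπ-as-sub : ∀ r A → renπ r A ≡ sub (πS r) A
  renπ-as-sub r A = trans (sym (sub-id (renπ r A))) (trans (sub-renπ idS r A) (sub-ext (mk≈ (λ _ → refl) (λ _ _ → refl)) A))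

  ⊙-ext : ∀ {σ σ' τ τ'} → σ ≈S σ' → τ ≈S τ' → (σ ⊙ τ) ≈S (σ' ⊙ τ')
  ⊙-ext {σ} {σ'} {τ} {τ'} e f = mk≈ (λ j → trans (subT-ext (≈i e) (ind τ j)) (cong (subT (ind σ')) (≈i f j)))
    (λ n i → trans (sub-ext (liftSι-ext n e) (prd τ n i)) (cong (sub (liftSι n σ')) (≈p f n i)))

  ⊙-assoc : ∀ σ τ υ → ((σ ⊙ τ) ⊙ υ) ≈S (σ ⊙ (τ ⊙ υ))
  ⊙-assoc σ τ υ = mk≈ (λ j → sym (subT-comp (ind σ) (ind τ) (ind υ j)))
    (λ n i → sym (trans (sub-comp _ _ (prd υ n i)) (sub-ext (liftSι-⊙ n σ τ) (prd υ n i))))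

  ⊙-idl : ∀ σ → (idS ⊙ σ) ≈S σ
  ⊙-idl σ = mk≈ (λ j → subT-id (ind σ j)) (λ n i → trans (sub-ext (liftSι-id n) (prd σ n i)) (sub-id (prd σ n i)))

  inst-vars-lo : ∀ n k ρ j → j < n → inst (varsFrom n k) ρ j ≡ var (k + j)
  inst-vars-lo (suc n) k ρ zero p = cong var (sym (+-identityʳ k))
  inst-vars-lo (suc n) k ρ (suc j) (s<s p) = trans (inst-vars-lo n (suc k) ρ j p) (cong var (sym (+-suc k j)))

  vars-unshift : ∀ n → (inst (varsFrom n 0) var ⊚ liftι n (shiftι n)) ≐ var
  vars-unshift n = split≐ n
    (λ j p → trans (cong (subT (inst (varsFrom n 0) var)) (liftι-lo n (shiftι n) j p)) (inst-vars-lo n 0 var j p))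
    (λ j → trans (cong (subT (inst (varsFrom n 0) var)) (liftι-hi n (shiftι n) j)) (inst-hi (varsFrom n 0) var (n + j)))

  ⊙-idr : ∀ σ → (σ ⊙ idS) ≈S σ
  ⊙-idr σ = mk≈ (λ _ → refl) (λ n i →
    trans (cong (λ X → subι (inst X var) (subι (liftι n (shiftι n)) (prd σ n i))) (liftι-vars n (ind σ)))
      (trans (subι-comp _ _ (prd σ n i)) (trans (subι-ext (vars-unshift n) (prd σ n i)) (subι-id (prd σ n i)))))

  liftSι-ιS : ∀ n ρ → liftSι n (ιS ρ) ≈S ιS (liftι n ρ)
  liftSι-ιS n ρ = mk≈ (λ _ → refl) (λ m i → idbody-lift m (shiftι n) i)

  liftSι-πS : ∀ n r → liftSι n (πS r) ≈S πS r
  liftSι-πS n r = mk≈ (liftι-id n) (λ m i → idbody-lift m (shiftι n) (r m i))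

  sub-liftιS : ∀ n ρ X → sub (liftSι n (ιS ρ)) X ≡ subι (liftι n ρ) X
  sub-liftιS n ρ X = trans (sub-ext (liftSι-ιS n ρ) X) (sym (subι-as-sub _ X))

  sub-liftπS : ∀ n r X → sub (liftSι n (πS r)) X ≡ renπ r X
  sub-liftπS n r X = trans (sub-ext (liftSι-πS n r) X) (sym (renπ-as-sub _ X))

  liftSπ-ιS : ∀ b ρ → liftSπ b (ιS ρ) ≈S ιS ρ
  liftSπ-ιS b ρ = mk≈ (λ _ → refl) (λ n i → trans (liftSπ-prd-ext b {ιS ρ} {idS} (λ _ _ → refl) n i) (≈p (liftSπ-id b) n i))

module Polarity (S : Signature) where
  open Syntax S
  open Substitution S

  -- Polarities; Pl pos is Pos and Pl neg is Neg, so that positivity and negativity can be treated uniformly.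
  data Pol : Set where
    pos neg : Pol

  flipP : Pol → Pol
  flipP pos = neg
  flipP neg = pos

  flip-flip : ∀ p → flipP (flipP p) ≡ p
  flip-flip pos = refl
  flip-flip neg = refl

  Pl : Pol → ℕ → ℕ → Fm → Set
  Pl pos = Pos
  Pl neg = Neg

  Pos⇒ : ∀ {m k A B} → Pos m k (A ⇒ B) → Neg m k A × Pos m k B
  Pos⇒ (a ⇒ b) = a , b
  Neg⇒ : ∀ {m k A B} → Neg m k (A ⇒ B) → Pos m k A × Neg m k B
  Neg⇒ (a ⇒ b) = a , b

  Pl⇒ : ∀ p {m k A B} → Pl p m k (A ⇒ B) → Pl (flipP p) m k A × Pl p m k B
  Pl⇒ pos = Pos⇒
  Pl⇒ neg = Neg⇒

  mkPl⇒ : ∀ p {m k A B} → Pl (flipP p) m k A → Pl p m k B → Pl p m k (A ⇒ B)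
  mkPl⇒ pos a b = a ⇒ b
  mkPl⇒ neg a b = a ⇒ b

  Pl∀ι : ∀ p {m k A} → Pl p m k (∀ι A) → Pl p m k A
  Pl∀ι pos (∀ι a) = a
  Pl∀ι neg (∀ι a) = a
  mkPl∀ι : ∀ p {m k A} → Pl p m k A → Pl p m k (∀ι A)
  mkPl∀ι pos a = ∀ι a
  mkPl∀ι neg a = ∀ι a

  Pl∀π : ∀ p {m k n A} → Pl p m k (∀π n A) → Pl p m (shiftπ n m k) A
  Pl∀π pos (∀π a) = a
  Pl∀π neg (∀π a) = a
  mkPl∀π : ∀ p {m k n A} → Pl p m (shiftπ n m k) A → Pl p m k (∀π n A)
  mkPl∀π pos a = ∀π a
  mkPl∀π neg a = ∀π a

  Plμ : ∀ p {m k n D ts} → Pl p m k (μ n D ts) → Pl p m (shiftπ n m k) D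
  Plμ pos (μ a) = a
  Plμ neg (μ a) = a
  mkPlμ : ∀ p {m k n D ts} → Pl p m (shiftπ n m k) D → Pl p m k (μ n D ts)
  mkPlμ pos a = μ a
  mkPlμ neg a = μ a

  Pl⊥ : ∀ p {m k} → Pl p m k ⊥'
  Pl⊥ pos = ⊥'
  Pl⊥ neg = ⊥'

  Plcon : ∀ p {m k P ts} → Pl p m k (pcon P ts)
  Plcon pos = pcon
  Plcon neg = pcon

  Pl-subι : ∀ p {m k} ρ A → Pl p m k A → Pl p m k (subι ρ A)
  Pl-subι pos ρ ⊥' h = ⊥'
  Pl-subι neg ρ ⊥' h = ⊥'
  Pl-subι pos ρ (pvar n i ts) h = pvar
  Pl-subι neg ρ (pvar n i ts) (pvar x) = pvar x
  Pl-subι pos ρ (pcon P ts) h = pcon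
  Pl-subι neg ρ (pcon P ts) h = pcon
  Pl-subι p ρ (A ⇒ B) h = mkPl⇒ p (Pl-subι (flipP p) ρ A (proj₁ (Pl⇒ p h))) (Pl-subι p ρ B (proj₂ (Pl⇒ p h)))
  Pl-subι p ρ (∀ι A) h = mkPl∀ι p (Pl-subι p _ A (Pl∀ι p h))
  Pl-subι p ρ (∀π n A) h = mkPl∀π p (Pl-subι p _ A (Pl∀π p h))
  Pl-subι p ρ (μ n D ts) h = mkPlμ p (Pl-subι p _ D (Plμ p h))

  Pl-subι⁻ : ∀ p {m k} ρ A → Pl p m k (subι ρ A) → Pl p m k A
  Pl-subι⁻ pos ρ ⊥' h = ⊥'
  Pl-subι⁻ neg ρ ⊥' h = ⊥'
  Pl-subι⁻ pos ρ (pvar n i ts) h = pvar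
  Pl-subι⁻ neg ρ (pvar n i ts) (pvar x) = pvar x
  Pl-subι⁻ pos ρ (pcon P ts) h = pcon
  Pl-subι⁻ neg ρ (pcon P ts) h = pcon
  Pl-subι⁻ p ρ (A ⇒ B) h = mkPl⇒ p (Pl-subι⁻ (flipP p) ρ A (proj₁ (Pl⇒ p h))) (Pl-subι⁻ p ρ B (proj₂ (Pl⇒ p h)))
  Pl-subι⁻ p ρ (∀ι A) h = mkPl∀ι p (Pl-subι⁻ p _ A (Pl∀ι p h))
  Pl-subι⁻ p ρ (∀π n A) h = mkPl∀π p (Pl-subι⁻ p _ A (Pl∀π p h))
  Pl-subι⁻ p ρ (μ n D ts) h = mkPlμ p (Pl-subι⁻ p _ D (Plμ p h))

  Occ-subι : ∀ {m k} ρ A → Occurs m k A → Occurs m k (subι ρ A)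
  Occ-subι ρ (pvar n i ts) here = here
  Occ-subι ρ (A ⇒ B) (⇒ˡ o) = ⇒ˡ (Occ-subι ρ A o)
  Occ-subι ρ (A ⇒ B) (⇒ʳ o) = ⇒ʳ (Occ-subι ρ B o)
  Occ-subι ρ (∀ι A) (∀ι o) = ∀ι (Occ-subι _ A o)
  Occ-subι ρ (∀π n A) (∀π o) = ∀π (Occ-subι _ A o)
  Occ-subι ρ (μ n D ts) (μ o) = μ (Occ-subι _ D o)

  Occ-subι⁻ : ∀ {m k} ρ A → Occurs m k (subι ρ A) → Occurs m k A
  Occ-subι⁻ ρ (pvar n i ts) here = here
  Occ-subι⁻ ρ (A ⇒ B) (⇒ˡ o) = ⇒ˡ (Occ-subι⁻ ρ A o)
  Occ-subι⁻ ρ (A ⇒ B) (⇒ʳ o) = ⇒ʳ (Occ-subι⁻ ρ B o)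
  Occ-subι⁻ ρ (∀ι A) (∀ι o) = ∀ι (Occ-subι⁻ _ A o)
  Occ-subι⁻ ρ (∀π n A) (∀π o) = ∀π (Occ-subι⁻ _ A o)
  Occ-subι⁻ ρ (μ n D ts) (μ o) = μ (Occ-subι⁻ _ D o)

  WF-subι : ∀ ρ A → WF A → WF (subι ρ A)
  WF-subι ρ ⊥' w = ⊥'
  WF-subι ρ (pvar n i ts) w = pvar
  WF-subι ρ (pcon P ts) w = pcon
  WF-subι ρ (A ⇒ B) (a ⇒ b) = WF-subι ρ A a ⇒ WF-subι ρ B b
  WF-subι ρ (∀ι A) (∀ι a) = ∀ι (WF-subι _ A a)
  WF-subι ρ (∀π n A) (∀π a) = ∀π (WF-subι _ A a)
  WF-subι ρ (μ m D ts) (μ w o p) = μ (WF-subι _ D w) (Occ-subι _ D o) (Pl-subι pos _ D p)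

  WF-subι⁻ : ∀ ρ A → WF (subι ρ A) → WF A
  WF-subι⁻ ρ ⊥' w = ⊥'
  WF-subι⁻ ρ (pvar n i ts) w = pvar
  WF-subι⁻ ρ (pcon P ts) w = pcon
  WF-subι⁻ ρ (A ⇒ B) (a ⇒ b) = WF-subι⁻ ρ A a ⇒ WF-subι⁻ ρ B b
  WF-subι⁻ ρ (∀ι A) (∀ι a) = ∀ι (WF-subι⁻ _ A a)
  WF-subι⁻ ρ (∀π n A) (∀π a) = ∀π (WF-subι⁻ _ A a)
  WF-subι⁻ ρ (μ m D ts) (μ w o p) = μ (WF-subι⁻ _ D w) (Occ-subι⁻ _ D o) (Pl-subι⁻ pos _ D p)

  Inj : Ren → Set
  Inj r = ∀ n i j → r n i ≡ r n j → i ≡ j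

  shiftπ-inj : ∀ b → Inj (shiftπ b)
  shiftπ-inj b n i j e with n ≡ᵇ b
  ... | true = suc-injective e
  ... | false = e

  liftπ-inj : ∀ b r → Inj r → Inj (liftπ b r)
  liftπ-inj b r h n zero zero e = refl
  liftπ-inj b r h n zero (suc j) e with n ≡ᵇ b
  ... | true = ⊥-elim (0≢1+n e)
  ... | false = h n 0 (suc j) e
  liftπ-inj b r h n (suc i) zero e with n ≡ᵇ b
  ... | true = ⊥-elim (0≢1+n (sym e))
  ... | false = h n (suc i) 0 e
  liftπ-inj b r h n (suc i) (suc j) e with n ≡ᵇ b
  ... | true = cong suc (h n i j (suc-injective e))
  ... | false = h n (suc i) (suc j) e

  Pl-renπ : ∀ p {m k} r → Inj r → ∀ A → Pl p m k A → Pl p m (r m k) (renπ r A)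
  Pl-renπ pos r h ⊥' a = ⊥'
  Pl-renπ neg r h ⊥' a = ⊥'
  Pl-renπ pos r h (pvar n i ts) a = pvar
  Pl-renπ neg {m} {k} r h (pvar n i ts) (pvar x) = pvar λ { (refl , e) → x (refl , h n i k e) }
  Pl-renπ pos r h (pcon P ts) a = pcon
  Pl-renπ neg r h (pcon P ts) a = pcon
  Pl-renπ p r h (A ⇒ B) a = mkPl⇒ p (Pl-renπ (flipP p) r h A (proj₁ (Pl⇒ p a))) (Pl-renπ p r h B (proj₂ (Pl⇒ p a)))
  Pl-renπ p r h (∀ι A) a = mkPl∀ι p (Pl-renπ p r h A (Pl∀ι p a))
  Pl-renπ p {m} {k} r h (∀π n A) a = mkPl∀π p (subst (λ z → Pl p m z (renπ (liftπ n r) A)) (liftπ-shift n r m k)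
    (Pl-renπ p (liftπ n r) (liftπ-inj n r h) A (Pl∀π p a)))
  Pl-renπ p {m} {k} r h (μ n D ts) a = mkPlμ p (subst (λ z → Pl p m z (renπ (liftπ n r) D)) (liftπ-shift n r m k)
    (Pl-renπ p (liftπ n r) (liftπ-inj n r h) D (Plμ p a)))

  Occ-renπ : ∀ {m k} r A → Occurs m k A → Occurs m (r m k) (renπ r A)
  Occ-renπ r (pvar n i ts) here = here
  Occ-renπ r (A ⇒ B) (⇒ˡ o) = ⇒ˡ (Occ-renπ r A o)
  Occ-renπ r (A ⇒ B) (⇒ʳ o) = ⇒ʳ (Occ-renπ r B o)
  Occ-renπ r (∀ι A) (∀ι o) = ∀ι (Occ-renπ r A o)
  Occ-renπ {m} {k} r (∀π n A) (∀π o) = ∀π (subst (λ z → Occurs m z (renπ (liftπ n r) A)) (liftπ-shift n r m k)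
      (Occ-renπ _ A o))
  Occ-renπ {m} {k} r (μ n D ts) (μ o) = μ (subst (λ z → Occurs m z (renπ (liftπ n r) D)) (liftπ-shift n r m k)
      (Occ-renπ _ D o))

  unlift-occ : ∀ {m k' n} r {A} k → liftπ n r m k ≡ shiftπ n m k' → Occurs m k A →
    Σ ℕ λ k₀ → (r m k₀ ≡ k') × Occurs m (shiftπ n m k₀) A
  unlift-occ {m} {k'} {n} r zero e o with m ≡ᵇ n
  ... | true = ⊥-elim (0≢1+n e)
  ... | false = 0 , e , o
  unlift-occ {m} {k'} {n} r (suc k) e o with m ≡ᵇ n
  ... | true = k , suc-injective e , o
  ... | false = suc k , e , o

  Occ-renπ⁻ : ∀ {m k'} r A → Occurs m k' (renπ r A) → Σ ℕ λ k → (r m k ≡ k') × Occurs m k A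
  Occ-renπ⁻ r (pvar n i ts) here = i , refl , here
  Occ-renπ⁻ r (A ⇒ B) (⇒ˡ o) with Occ-renπ⁻ r A o
  ... | k , e , o' = k , e , ⇒ˡ o'
  Occ-renπ⁻ r (A ⇒ B) (⇒ʳ o) with Occ-renπ⁻ r B o
  ... | k , e , o' = k , e , ⇒ʳ o'
  Occ-renπ⁻ r (∀ι A) (∀ι o) with Occ-renπ⁻ r A o
  ... | k , e , o' = k , e , ∀ι o'
  Occ-renπ⁻ r (∀π n A) (∀π o) with Occ-renπ⁻ (liftπ n r) A o
  ... | k , e , o' with unlift-occ r k e o'
  ... | k₀ , e₀ , o₀ = k₀ , e₀ , ∀π o₀
  Occ-renπ⁻ r (μ n D ts) (μ o) with Occ-renπ⁻ (liftπ n r) D o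
  ... | k , e , o' with unlift-occ r k e o'
  ... | k₀ , e₀ , o₀ = k₀ , e₀ , μ o₀

  Pl-renπ⁻ : ∀ p {m k} r A → Pl p m (r m k) (renπ r A) → Pl p m k A
  Pl-renπ⁻ pos r ⊥' a = ⊥'
  Pl-renπ⁻ neg r ⊥' a = ⊥'
  Pl-renπ⁻ pos r (pvar n i ts) a = pvar
  Pl-renπ⁻ neg {m} {k} r (pvar n i ts) (pvar x) = pvar λ { (refl , refl) → x (refl , refl) }
  Pl-renπ⁻ pos r (pcon P ts) a = pcon
  Pl-renπ⁻ neg r (pcon P ts) a = pcon
  Pl-renπ⁻ p r (A ⇒ B) a = mkPl⇒ p (Pl-renπ⁻ (flipP p) r A (proj₁ (Pl⇒ p a))) (Pl-renπ⁻ p r B (proj₂ (Pl⇒ p a)))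
  Pl-renπ⁻ p r (∀ι A) a = mkPl∀ι p (Pl-renπ⁻ p r A (Pl∀ι p a))
  Pl-renπ⁻ p {m} {k} r (∀π n A) a = mkPl∀π p (Pl-renπ⁻ p (liftπ n r) A
    (subst (λ z → Pl p m z (renπ (liftπ n r) A)) (sym (liftπ-shift n r m k)) (Pl∀π p a)))
  Pl-renπ⁻ p {m} {k} r (μ n D ts) a = mkPlμ p (Pl-renπ⁻ p (liftπ n r) D
    (subst (λ z → Pl p m z (renπ (liftπ n r) D)) (sym (liftπ-shift n r m k)) (Plμ p a)))

  liftπ-new : ∀ m r → liftπ m r m 0 ≡ 0
  liftπ-new m r = liftπ-bound-zero m r m (≡ᵇ-refl m)

  WF-renπ : ∀ r → Inj r → ∀ A → WF A → WF (renπ r A)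
  WF-renπ r h ⊥' w = ⊥'
  WF-renπ r h (pvar n i ts) w = pvar
  WF-renπ r h (pcon P ts) w = pcon
  WF-renπ r h (A ⇒ B) (a ⇒ b) = WF-renπ r h A a ⇒ WF-renπ r h B b
  WF-renπ r h (∀ι A) (∀ι a) = ∀ι (WF-renπ r h A a)
  WF-renπ r h (∀π n A) (∀π a) = ∀π (WF-renπ _ (liftπ-inj n r h) A a)
  WF-renπ r h (μ m D ts) (μ w o p) = μ (WF-renπ _ (liftπ-inj m r h) D w)
    (subst (λ z → Occurs m z (renπ (liftπ m r) D)) (liftπ-new m r) (Occ-renπ (liftπ m r) D o))
    (subst (λ z → Pos m z (renπ (liftπ m r) D)) (liftπ-new m r) (Pl-renπ pos (liftπ m r) (liftπ-inj m r h) D p))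

  WF-renπ⁻ : ∀ r A → WF (renπ r A) → WF A
  WF-renπ⁻ r ⊥' w = ⊥'
  WF-renπ⁻ r (pvar n i ts) w = pvar
  WF-renπ⁻ r (pcon P ts) w = pcon
  WF-renπ⁻ r (A ⇒ B) (a ⇒ b) = WF-renπ⁻ r A a ⇒ WF-renπ⁻ r B b
  WF-renπ⁻ r (∀ι A) (∀ι a) = ∀ι (WF-renπ⁻ r A a)
  WF-renπ⁻ r (∀π n A) (∀π a) = ∀π (WF-renπ⁻ _ A a)
  WF-renπ⁻ r (μ m D ts) (μ w o p) = μ (WF-renπ⁻ _ D w) (occ (Occ-renπ⁻ (liftπ m r) D o))
    (Pl-renπ⁻ pos (liftπ m r) D (subst (λ z → Pos m z (renπ (liftπ m r) D)) (sym (liftπ-new m r)) p))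
    where
    occ : Σ ℕ (λ k → (liftπ m r m k ≡ 0) × Occurs m k D) → Occurs m 0 D
    occ (zero , e , o') = o'
    occ (suc k , e , o') = ⊥-elim (0≢1+n (sym (trans (sym (liftπ-bound-suc m r m k (≡ᵇ-refl m))) e)))

  notOcc-Pl : ∀ p {m k} B → ¬ Occurs m k B → Pl p m k B
  notOcc-Pl pos ⊥' h = ⊥'
  notOcc-Pl neg ⊥' h = ⊥'
  notOcc-Pl pos (pvar n i ts) h = pvar
  notOcc-Pl neg (pvar n i ts) h = pvar λ { (refl , refl) → h here }
  notOcc-Pl pos (pcon P ts) h = pcon
  notOcc-Pl neg (pcon P ts) h = pcon
  notOcc-Pl p (A ⇒ B) h = mkPl⇒ p (notOcc-Pl (flipP p) A (λ o → h (⇒ˡ o))) (notOcc-Pl p B (λ o → h (⇒ʳ o)))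
  notOcc-Pl p (∀ι A) h = mkPl∀ι p (notOcc-Pl p A (λ o → h (∀ι o)))
  notOcc-Pl p (∀π n A) h = mkPl∀π p (notOcc-Pl p A (λ o → h (∀π o)))
  notOcc-Pl p (μ n D ts) h = mkPlμ p (notOcc-Pl p D (λ o → h (μ o)))

  bound-or-shifted : ∀ b n j → (n ≡ b × j ≡ 0) ⊎ (Σ ℕ λ i → shiftπ b n i ≡ j)
  bound-or-shifted b n zero with n ≡ᵇ b in eq
  ... | true = inj₁ (≡ᵇ-sound n b eq , refl)
  ... | false = inj₂ (0 , refl)
  bound-or-shifted b n (suc j) with n ≡ᵇ b
  ... | true = inj₂ (j , refl)
  ... | false = inj₂ (suc j , refl)

  shiftπ-self : ∀ b k → shiftπ b b k ≡ suc k
  shiftπ-self b k = shiftπ-bound b b k (≡ᵇ-refl b)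

  new≢shift : ∀ b m k' → ¬ (b ≡ m × 0 ≡ shiftπ b m k')
  new≢shift b .b k' (refl , e) = 0≢1+n (trans e (shiftπ-self b k'))

  occ-pvar : ∀ {m k n i ts} → Occurs m k (pvar n i ts) → (n ≡ m) × (i ≡ k)
  occ-pvar here = refl , refl

  idbody-notOcc : ∀ b m k' → ¬ Occurs m (shiftπ b m k') (idbody b 0)
  idbody-notOcc b m k' o with occ-pvar o
  ... | e1 , e2 = new≢shift b m k' (e1 , e2)

  prd-liftSπ-new : ∀ b σ → prd (liftSπ b σ) b 0 ≡ idbody b 0
  prd-liftSπ-new b σ = liftSπ-bound-zero b σ b (≡ᵇ-refl b)

  shift-notOcc : ∀ m B → ¬ Occurs m 0 (renπ (shiftπ m) B)
  shift-notOcc m B o with Occ-renπ⁻ (shiftπ m) B o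
  ... | k , e , _ = 0≢1+n (sym (trans (sym (shiftπ-self m k)) e))

  renπ-notOcc : ∀ b m k' B → ¬ Occurs m k' B → ¬ Occurs m (shiftπ b m k') (renπ (shiftπ b) B)
  renπ-notOcc b m k' B h o with Occ-renπ⁻ (shiftπ b) B o
  ... | k , e , o' = h (subst (λ z → Occurs m z B) (shiftπ-inj b m k k' e) o')

  MapsToVar : Subst → ℕ → ℕ → ℕ → Set
  MapsToVar σ m k k' = Σ (Vec Term m) λ us → prd σ m k ≡ pvar m k' us

  MapsToVar-liftSι : ∀ j σ m k k' → MapsToVar σ m k k' → MapsToVar (liftSι j σ) m k k'
  MapsToVar-liftSι j σ m k k' (us , e) = subTs (liftι m (shiftι j)) us , cong (subι (liftι m (shiftι j))) e

  MapsToVar-liftSπ : ∀ b σ m k k' → MapsToVar σ m k k' → MapsToVar (liftSπ b σ) m (shiftπ b m k) (shiftπ b m k')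
  MapsToVar-liftSπ b σ m k k' (us , e) = us , trans (liftSπ-shifted b σ m k) (cong (renπ (shiftπ b)) e)

  MapsToVar-new : ∀ m σ → MapsToVar (liftSι m (liftSπ m σ)) m 0 0
  MapsToVar-new m σ = subTs (liftι m (shiftι m)) (varsFrom m 0) , cong (subι (liftι m (shiftι m))) (prd-liftSπ-new m σ)

  Occ-sub : ∀ {m k k'} σ A → Occurs m k A → MapsToVar σ m k k' → Occurs m k' (sub σ A)
  Occ-sub σ (pvar n i ts) here (us , e) rewrite e = here
  Occ-sub σ (A ⇒ B) (⇒ˡ o) iv = ⇒ˡ (Occ-sub σ A o iv)
  Occ-sub σ (A ⇒ B) (⇒ʳ o) iv = ⇒ʳ (Occ-sub σ B o iv)
  Occ-sub {m} {k} {k'} σ (∀ι A) (∀ι o) iv = ∀ι (Occ-sub _ A o (MapsToVar-liftSι 1 σ m k k' iv))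
  Occ-sub {m} {k} {k'} σ (∀π n A) (∀π o) iv = ∀π (Occ-sub _ A o (MapsToVar-liftSπ n σ m k k' iv))
  Occ-sub {m} {k} {k'} σ (μ n D ts) (μ o) iv = μ (Occ-sub _ D o
      (MapsToVar-liftSι n (liftSπ n σ) m (shiftπ n m k) (shiftπ n m k') (MapsToVar-liftSπ n σ m k k' iv)))

  Pl-sub⁻ : ∀ p {m k k'} σ A → Pl p m k' (sub σ A) → MapsToVar σ m k k' → Pl p m k A
  Pl-sub⁻ pos σ ⊥' h iv = ⊥'
  Pl-sub⁻ neg σ ⊥' h iv = ⊥'
  Pl-sub⁻ pos σ (pvar n i ts) h iv = pvar
  Pl-sub⁻ neg {m} {k} {k'} σ (pvar n i ts) h (us , e) = pvar λ { (refl , refl) → bad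
      (subst (λ X → Neg m k' (subι _ X)) e h) }
    where
    bad : ∀ {ρ} → Neg m k' (subι ρ (pvar m k' us)) → ⊥
    bad (pvar x) = x (refl , refl)
  Pl-sub⁻ pos σ (pcon P ts) h iv = pcon
  Pl-sub⁻ neg σ (pcon P ts) h iv = pcon
  Pl-sub⁻ p σ (A ⇒ B) h iv = mkPl⇒ p (Pl-sub⁻ (flipP p) σ A (proj₁ (Pl⇒ p h)) iv) (Pl-sub⁻ p σ B (proj₂ (Pl⇒ p h)) iv)
  Pl-sub⁻ p {m} {k} {k'} σ (∀ι A) h iv = mkPl∀ι p (Pl-sub⁻ p _ A (Pl∀ι p h) (MapsToVar-liftSι 1 σ m k k' iv))
  Pl-sub⁻ p {m} {k} {k'} σ (∀π n A) h iv = mkPl∀π p (Pl-sub⁻ p _ A (Pl∀π p h) (MapsToVar-liftSπ n σ m k k' iv))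
  Pl-sub⁻ p {m} {k} {k'} σ (μ n D ts) h iv = mkPlμ p (Pl-sub⁻ p _ D (Plμ p h)
      (MapsToVar-liftSι n (liftSπ n σ) m (shiftπ n m k) (shiftπ n m k') (MapsToVar-liftSπ n σ m k k' iv)))

  -- OthersAvoid σ m k k': no body of σ other than the one at k contains k'.  Together with
  -- MapsToVar this lets occurrences of k' in sub σ A be traced back to A.
  OthersAvoid : Subst → ℕ → ℕ → ℕ → Set
  OthersAvoid σ m k k' = ∀ n i → ¬ (n ≡ m × i ≡ k) → ¬ Occurs m k' (prd σ n i)

  OthersAvoid-liftSι : ∀ j σ m k k' → OthersAvoid σ m k k' → OthersAvoid (liftSι j σ) m k k'
  OthersAvoid-liftSι j σ m k k' h n i ne o = h n i ne (Occ-subι⁻ _ (prd σ n i) o)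

  OthersAvoid-liftSπ : ∀ b σ m k k' → OthersAvoid σ m k k' → OthersAvoid (liftSπ b σ) m (shiftπ b m k) (shiftπ b m k')
  OthersAvoid-liftSπ b σ m k k' h n j ne o with bound-or-shifted b n j
  ... | inj₁ (refl , refl) = idbody-notOcc b m k' (subst (Occurs m (shiftπ b m k')) (prd-liftSπ-new b σ) o)
  ... | inj₂ (i , refl) = renπ-notOcc b m k' (prd σ n i) (h n i (λ { (refl , refl) → ne (refl , refl) }))
    (subst (Occurs m (shiftπ b m k')) (liftSπ-shifted b σ n i) o)

  OthersAvoid-new : ∀ m σ → OthersAvoid (liftSι m (liftSπ m σ)) m 0 0
  OthersAvoid-new m σ = OthersAvoid-liftSι m (liftSπ m σ) m 0 0 h
    where
    h : OthersAvoid (liftSπ m σ) m 0 0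
    h n j ne o with bound-or-shifted m n j
    ... | inj₁ (refl , refl) = ne (refl , refl)
    ... | inj₂ (i , refl) = shift-notOcc m (prd σ n i) (subst (Occurs m 0) (liftSπ-shifted m σ n i) o)

  Occ-sub⁻ : ∀ {m k k'} σ A → Occurs m k' (sub σ A) → MapsToVar σ m k k' → OthersAvoid σ m k k' → Occurs m k A
  Occ-sub⁻ {m} {k} {k'} σ (pvar n i ts) o iv h with n ≟ m | i ≟ k
  ... | yes refl | yes refl = here
  ... | no ne | _ = ⊥-elim (h n i (λ { (a , _) → ne a }) (Occ-subι⁻ _ (prd σ n i) o))
  ... | yes refl | no ne = ⊥-elim (h n i (λ { (_ , b) → ne b }) (Occ-subι⁻ _ (prd σ n i) o))
  Occ-sub⁻ σ (A ⇒ B) (⇒ˡ o) iv h = ⇒ˡ (Occ-sub⁻ σ A o iv h)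
  Occ-sub⁻ σ (A ⇒ B) (⇒ʳ o) iv h = ⇒ʳ (Occ-sub⁻ σ B o iv h)
  Occ-sub⁻ {m} {k} {k'} σ (∀ι A) (∀ι o) iv h = ∀ι (Occ-sub⁻ _ A o (MapsToVar-liftSι 1 σ m k k' iv)
      (OthersAvoid-liftSι 1 σ m k k' h))
  Occ-sub⁻ {m} {k} {k'} σ (∀π n A) (∀π o) iv h = ∀π (Occ-sub⁻ _ A o (MapsToVar-liftSπ n σ m k k' iv)
      (OthersAvoid-liftSπ n σ m k k' h))
  Occ-sub⁻ {m} {k} {k'} σ (μ n D ts) (μ o) iv h = μ (Occ-sub⁻ _ D o
    (MapsToVar-liftSι n (liftSπ n σ) m (shiftπ n m k) (shiftπ n m k') (MapsToVar-liftSπ n σ m k k' iv))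
        (OthersAvoid-liftSι n (liftSπ n σ) m (shiftπ n m k) (shiftπ n m k') (OthersAvoid-liftSπ n σ m k k' h)))

  -- Classified p m k' σ PA NA: each body of σ either has polarity p in k' (at variables satisfying PA),
  -- the opposite polarity (at variables satisfying NA), or does not contain k'.  Then k' has
  -- polarity p in sub σ A whenever the positive/negative variables of A are classified accordingly.
  record Classified (p : Pol) (m k' : ℕ) (σ : Subst) (PA NA : ℕ → ℕ → Set) : Set where
    field
      classify : ∀ n i → (PA n i × Pl p m k' (prd σ n i)) ⊎
          (NA n i × Pl (flipP p) m k' (prd σ n i)) ⊎ ¬ Occurs m k' (prd σ n i)
  open Classified public

  Classified-mono : ∀ {p m k' σ PA NA PA' NA'} → (∀ n i → PA n i → PA' n i) → (∀ n i → NA n i → NA' n i) →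
    Classified p m k' σ PA NA → Classified p m k' σ PA' NA'
  Classified-mono f g c .classify n i with c .classify n i
  ... | inj₁ (a , b) = inj₁ (f n i a , b)
  ... | inj₂ (inj₁ (a , b)) = inj₂ (inj₁ (g n i a , b))
  ... | inj₂ (inj₂ x) = inj₂ (inj₂ x)

  Classified-flip : ∀ {p m k' σ PA NA PA' NA'} → (∀ n i → PA n i → NA' n i) → (∀ n i → NA n i → PA' n i) →
    Classified p m k' σ PA NA → Classified (flipP p) m k' σ PA' NA'
  Classified-flip {p} {m} {k'} {σ} f g c .classify n i with c .classify n i
  ... | inj₁ (a , b) = inj₂ (inj₁ (f n i a , subst (λ q → Pl q m k' (prd σ n i)) (sym (flip-flip p)) b))
  ... | inj₂ (inj₁ (a , b)) = inj₁ (g n i a , b)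
  ... | inj₂ (inj₂ x) = inj₂ (inj₂ x)

  Classified-liftSι : ∀ {p m k' σ PA NA} j → Classified p m k' σ PA NA → Classified p m k' (liftSι j σ) PA NA
  Classified-liftSι {p} {σ = σ} j c .classify n i with c .classify n i
  ... | inj₁ (a , b) = inj₁ (a , Pl-subι p _ (prd σ n i) b)
  ... | inj₂ (inj₁ (a , b)) = inj₂ (inj₁ (a , Pl-subι (flipP p) _ (prd σ n i) b))
  ... | inj₂ (inj₂ x) = inj₂ (inj₂ (λ o → x (Occ-subι⁻ _ (prd σ n i) o)))

  ShiftedAt : ℕ → (ℕ → ℕ → Set) → ℕ → ℕ → Set
  ShiftedAt b PA n j = Σ ℕ λ i → (shiftπ b n i ≡ j) × PA n i

  Classified-liftSπ : ∀ {p m k' σ PA NA} b → Classified p m k' σ PA NA → Classified p m (shiftπ b m k')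
      (liftSπ b σ) (ShiftedAt b PA) (ShiftedAt b NA)
  Classified-liftSπ {p} {m} {k'} {σ} b c .classify n j with bound-or-shifted b n j
  ... | inj₁ (refl , refl) = inj₂ (inj₂
      (λ o → idbody-notOcc b m k' (subst (Occurs m (shiftπ b m k')) (prd-liftSπ-new b σ) o)))
  ... | inj₂ (i , refl) with c .classify n i
  ...   | inj₁ (a , x) = inj₁ ((i , refl , a) , subst (Pl p m (shiftπ b m k')) (sym (liftSπ-shifted b σ n i))
            (Pl-renπ p (shiftπ b) (shiftπ-inj b) (prd σ n i) x))
  ...   | inj₂ (inj₁ (a , x)) = inj₂ (inj₁
      ((i , refl , a) , subst (Pl (flipP p) m (shiftπ b m k')) (sym (liftSπ-shifted b σ n i))
            (Pl-renπ (flipP p) (shiftπ b) (shiftπ-inj b) (prd σ n i) x)))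
  ...   | inj₂ (inj₂ x) = inj₂ (inj₂
      (λ o → renπ-notOcc b m k' (prd σ n i) x (subst (Occurs m (shiftπ b m k')) (liftSπ-shifted b σ n i) o)))

  neg-self : ∀ {n i ts} → Neg n i (pvar n i ts) → ⊥
  neg-self (pvar x) = x (refl , refl)

  PosOf NegOf : Fm → ℕ → ℕ → Set
  PosOf A n i = Pos n i A
  NegOf A n i = Neg n i A

  positive-entry : ∀ q {m k' n i A X} → Pl q n i A → Pos m k' X →
    (PosOf A n i × Pl q m k' X) ⊎ (NegOf A n i × Pl (flipP q) m k' X) ⊎ ¬ Occurs m k' X
  positive-entry pos a x = inj₁ (a , x)
  positive-entry neg a x = inj₂ (inj₁ (a , x))

  Pl-sub : ∀ p {m k'} σ A → Classified p m k' σ (PosOf A) (NegOf A) → Pl p m k' (sub σ A)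
  Pl-sub p σ ⊥' c = Pl⊥ p
  Pl-sub p σ (pvar n i ts) c with c .classify n i
  ... | inj₁ (_ , b) = Pl-subι p _ (prd σ n i) b
  ... | inj₂ (inj₁ (a , _)) = ⊥-elim (neg-self a)
  ... | inj₂ (inj₂ x) = notOcc-Pl p _ (λ o → x (Occ-subι⁻ _ (prd σ n i) o))
  Pl-sub p σ (pcon P ts) c = Plcon p
  Pl-sub p {m} {k'} σ (A ⇒ B) c = mkPl⇒ p (Pl-sub (flipP p) σ A cA) (Pl-sub p σ B cB)
    where
    cA : Classified (flipP p) m k' σ (PosOf A) (NegOf A)
    cA = Classified-flip (λ n i a → proj₁ (Pos⇒ a)) (λ n i a → proj₁ (Neg⇒ a)) c
    cB : Classified p m k' σ (PosOf B) (NegOf B)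
    cB = Classified-mono (λ n i a → proj₂ (Pos⇒ a)) (λ n i a → proj₂ (Neg⇒ a)) c
  Pl-sub p {m} {k'} σ (∀ι A) c = mkPl∀ι p (Pl-sub p _ A (Classified-liftSι 1 cA))
    where
    cA : Classified p m k' σ (PosOf A) (NegOf A)
    cA = Classified-mono (λ n i a → Pl∀ι pos a) (λ n i a → Pl∀ι neg a) c
  Pl-sub p {m} {k'} σ (∀π b A) c = mkPl∀π p (Pl-sub p _ A cA)
    where
    cA : Classified p m (shiftπ b m k') (liftSπ b σ) (PosOf A) (NegOf A)
    cA = Classified-mono (λ { n j (i , refl , a) → Pl∀π pos a }) (λ { n j (i , refl , a) → Pl∀π neg a })
        (Classified-liftSπ b c)
  Pl-sub p {m} {k'} σ (μ b D ts) c = mkPlμ p (Pl-sub p _ D (Classified-liftSι b cD))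
    where
    cD : Classified p m (shiftπ b m k') (liftSπ b σ) (PosOf D) (NegOf D)
    cD = Classified-mono (λ { n j (i , refl , a) → Plμ pos a }) (λ { n j (i , refl , a) → Plμ neg a })
        (Classified-liftSπ b c)

  Classified-from : ∀ σ {m k k'} A → Pos m k A → MapsToVar σ m k k' → OthersAvoid σ m k k' →
      Classified pos m k' σ (PosOf A) (NegOf A)
  Classified-from σ {m} {k} {k'} A pa (us , e) h .classify n i with n ≟ m | i ≟ k
  ... | yes refl | yes refl = inj₁ (pa , subst (Pos m k') (sym e) pvar)
  ... | no ne | _ = inj₂ (inj₂ (h n i (λ { (a , _) → ne a })))
  ... | yes refl | no ne = inj₂ (inj₂ (h n i (λ { (_ , b) → ne b })))

  WFS : Subst → Set
  WFS σ = ∀ n i → WF (prd σ n i)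

  WFS-liftSι : ∀ j σ → WFS σ → WFS (liftSι j σ)
  WFS-liftSι j σ h n i = WF-subι _ (prd σ n i) (h n i)

  WFS-liftSπ : ∀ b σ → WFS σ → WFS (liftSπ b σ)
  WFS-liftSπ b σ h n j with bound-or-shifted b n j
  ... | inj₁ (refl , refl) = subst WF (sym (prd-liftSπ-new b σ)) pvar
  ... | inj₂ (i , refl) = subst WF (sym (liftSπ-shifted b σ n i)) (WF-renπ (shiftπ b) (shiftπ-inj b) (prd σ n i) (h n i))

  -- Well-formed substitutions preserve well-formedness; by MapsToVar-new and OthersAvoid-new the
  -- recursion variable of each μ keeps its occurrence and positivity.
  WF-sub : ∀ σ → WFS σ → ∀ A → WF A → WF (sub σ A)
  WF-sub σ h ⊥' w = ⊥'
  WF-sub σ h (pvar n i ts) w = WF-subι _ (prd σ n i) (h n i)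
  WF-sub σ h (pcon P ts) w = pcon
  WF-sub σ h (A ⇒ B) (a ⇒ b) = WF-sub σ h A a ⇒ WF-sub σ h B b
  WF-sub σ h (∀ι A) (∀ι a) = ∀ι (WF-sub _ (WFS-liftSι 1 σ h) A a)
  WF-sub σ h (∀π n A) (∀π a) = ∀π (WF-sub _ (WFS-liftSπ n σ h) A a)
  WF-sub σ h (μ m D ts) (μ w o p) = μ (WF-sub _ (WFS-liftSι m (liftSπ m σ) (WFS-liftSπ m σ h)) D w)
    (Occ-sub _ D o (MapsToVar-new m σ))
    (Pl-sub pos (liftSι m (liftSπ m σ)) D
        (Classified-from (liftSι m (liftSπ m σ)) D p (MapsToVar-new m σ) (OthersAvoid-new m σ)))

  WF-sub⁻ : ∀ σ A → WF (sub σ A) → WF A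
  WF-sub⁻ σ ⊥' w = ⊥'
  WF-sub⁻ σ (pvar n i ts) w = pvar
  WF-sub⁻ σ (pcon P ts) w = pcon
  WF-sub⁻ σ (A ⇒ B) (a ⇒ b) = WF-sub⁻ σ A a ⇒ WF-sub⁻ σ B b
  WF-sub⁻ σ (∀ι A) (∀ι a) = ∀ι (WF-sub⁻ _ A a)
  WF-sub⁻ σ (∀π n A) (∀π a) = ∀π (WF-sub⁻ _ A a)
  WF-sub⁻ σ (μ m D ts) (μ w o p) = μ (WF-sub⁻ _ D w) (Occ-sub⁻ _ D o (MapsToVar-new m σ) (OthersAvoid-new m σ))
    (Pl-sub⁻ pos _ D p (MapsToVar-new m σ))

  WF-body : ∀ σ {n i} A → WF (sub σ A) → Occurs n i A → WF (prd σ n i)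
  WF-body σ (pvar n i ts) w here = WF-subι⁻ _ (prd σ n i) w
  WF-body σ (A ⇒ B) (a ⇒ b) (⇒ˡ o) = WF-body σ A a o
  WF-body σ (A ⇒ B) (a ⇒ b) (⇒ʳ o) = WF-body σ B b o
  WF-body σ {n} {i} (∀ι A) (∀ι a) (∀ι o) = WF-subι⁻ _ (prd σ n i) (WF-body _ A a o)
  WF-body σ {n} {i} (∀π b A) (∀π a) (∀π o) =
    WF-renπ⁻ (shiftπ b) (prd σ n i) (subst WF (liftSπ-shifted b σ n i) (WF-body _ A a o))
  WF-body σ {n} {i} (μ b D ts) (μ w _ _) (μ o) =
    WF-renπ⁻ (shiftπ b) (prd σ n i) (subst WF (liftSπ-shifted b σ n i)
        (WF-subι⁻ _ (prd (liftSπ b σ) n (shiftπ b n i)) (WF-body _ D w o)))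

  shiftK : List Kind → ℕ → ℕ → ℕ
  shiftK [] m k = k
  shiftK (ι ∷ ks) m k = shiftK ks m k
  shiftK (π b ∷ ks) m k = shiftK ks m (shiftπ b m k)

  Pl-∀* : ∀ p vs {m k M} → Pl p m k (∀* vs M) → Pl p m (shiftK vs m k) M
  Pl-∀* p [] h = h
  Pl-∀* p (ι ∷ ks) h = Pl-∀* p ks (Pl∀ι p h)
  Pl-∀* p (π b ∷ ks) h = Pl-∀* p ks (Pl∀π p h)

  WF-∀*⇒ : ∀ vs {G D} → WF (∀* vs (G ⇒ D)) → WF G × WF D
  WF-∀*⇒ [] (g ⇒ d) = g , d
  WF-∀*⇒ (ι ∷ ks) (∀ι w) = WF-∀*⇒ ks w
  WF-∀*⇒ (π n ∷ ks) (∀π w) = WF-∀*⇒ ks w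

  Occ? : ∀ m k A → Dec (Occurs m k A)
  Occ? m k ⊥' = no λ ()
  Occ? m k (pvar n i ts) with n ≟ m | i ≟ k
  ... | yes refl | yes refl = yes here
  ... | no ne | _ = no λ o → ne (proj₁ (occ-pvar o))
  ... | yes refl | no ne = no λ o → ne (proj₂ (occ-pvar o))
  Occ? m k (pcon P ts) = no λ ()
  Occ? m k (A ⇒ B) with Occ? m k A | Occ? m k B
  ... | yes a | _ = yes (⇒ˡ a)
  ... | no na | yes b = yes (⇒ʳ b)
  ... | no na | no nb = no λ { (⇒ˡ a) → na a ; (⇒ʳ b) → nb b }
  Occ? m k (∀ι A) with Occ? m k A
  ... | yes a = yes (∀ι a)
  ... | no na = no λ { (∀ι a) → na a }
  Occ? m k (∀π n A) with Occ? m (shiftπ n m k) A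
  ... | yes a = yes (∀π a)
  ... | no na = no λ { (∀π a) → na a }
  Occ? m k (μ n D ts) with Occ? m (shiftπ n m k) D
  ... | yes a = yes (μ a)
  ... | no na = no λ { (μ a) → na a }

  record Agree (σ τ : Subst) (m k : ℕ) : Set where
    constructor mkAg
    field
      a-ind : ind σ ≐ ind τ
      a-oth : ∀ n i → ¬ (n ≡ m × i ≡ k) → prd σ n i ≡ prd τ n i
  open Agree public

  Agree-liftSι : ∀ j {σ τ m k} → Agree σ τ m k → Agree (liftSι j σ) (liftSι j τ) m k
  Agree-liftSι j a = mkAg (liftι-ext j (a-ind a)) (λ n i ne → cong (subι _) (a-oth a n i ne))

  Agree-liftSπ : ∀ b {σ τ m k} → Agree σ τ m k → Agree (liftSπ b σ) (liftSπ b τ) m (shiftπ b m k)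
  Agree-liftSπ b {σ} {τ} {m} {k} a = mkAg (a-ind a) oth
    where
    oth : ∀ n j → ¬ (n ≡ m × j ≡ shiftπ b m k) → prd (liftSπ b σ) n j ≡ prd (liftSπ b τ) n j
    oth n j ne with bound-or-shifted b n j
    ... | inj₁ (refl , refl) = trans (prd-liftSπ-new n σ) (sym (prd-liftSπ-new n τ))
    ... | inj₂ (i , refl) = trans (liftSπ-shifted b σ n i) (trans (cong (renπ (shiftπ b))
          (a-oth a n i (λ { (refl , refl) → ne (refl , refl) }))) (sym (liftSπ-shifted b τ n i)))

  Agree-⊙ : ∀ υ {σ τ m k} → Agree σ τ m k → Agree (υ ⊙ σ) (υ ⊙ τ) m k
  Agree-⊙ υ a = mkAg (λ j → cong (subT (ind υ)) (a-ind a j)) (λ n i ne → cong (sub (liftSι n υ)) (a-oth a n i ne))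

  sub-agree : ∀ {σ τ m k} A → Agree σ τ m k → ¬ Occurs m k A → sub σ A ≡ sub τ A
  sub-agree ⊥' a nO = refl
  sub-agree {σ} {τ} {m} {k} (pvar n i ts) a nO with n ≟ m | i ≟ k
  ... | yes refl | yes refl = ⊥-elim (nO here)
  ... | no ne | _ = cong₂ (λ X Y → subι (inst X var) Y) (subTs-ext (a-ind a) ts) (a-oth a n i (λ { (x , _) → ne x }))
  ... | yes refl | no ne = cong₂ (λ X Y → subι (inst X var) Y) (subTs-ext (a-ind a) ts) (a-oth a n i (λ { (_ , y) → ne y }))
  sub-agree (pcon P ts) a nO = cong (pcon P) (subTs-ext (a-ind a) ts)
  sub-agree (A ⇒ B) a nO = cong₂ _⇒_ (sub-agree A a (λ o → nO (⇒ˡ o))) (sub-agree B a (λ o → nO (⇒ʳ o)))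
  sub-agree (∀ι A) a nO = cong ∀ι (sub-agree A (Agree-liftSι 1 a) (λ o → nO (∀ι o)))
  sub-agree (∀π n A) a nO = cong (∀π n) (sub-agree A (Agree-liftSπ n a) (λ o → nO (∀π o)))
  sub-agree (μ b D ts) a nO = cong₂ (μ b) (sub-agree D (Agree-liftSι b (Agree-liftSπ b a)) (λ o → nO (μ o)))
      (subTs-ext (a-ind a) ts)

module FixedPointSubstitutions (S : Signature) where
  open Syntax S
  open Substitution S
  open Polarity S

  sub-idbody : ∀ n τ i → sub (liftSι n τ) (idbody n i) ≡ prd τ n i
  sub-idbody n τ i = ≈p (⊙-idr τ) n i

  replC-new : ∀ m X → replC m X m 0 ≡ X
  replC-new m X rewrite ≡ᵇ-refl m = refl

  replC-shift : ∀ m X k l → replC m X k (shiftπ m k l) ≡ idbody k l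
  replC-shift m X k zero with k ≡ᵇ m in eq
  ... | true rewrite eq = refl
  ... | false rewrite eq = refl
  replC-shift m X k (suc l) with k ≡ᵇ m in eq
  ... | true rewrite eq = refl
  ... | false rewrite eq = refl

  replC-others : ∀ m X Y n i → ¬ (n ≡ m × i ≡ 0) → replC m X n i ≡ replC m Y n i
  replC-others m X Y n i ne with bound-or-shifted m n i
  ... | inj₁ bound = ⊥-elim (ne bound)
  ... | inj₂ (i' , refl) = trans (replC-shift m X n i') (sym (replC-shift m Y n i'))

  liftSπ-liftSι : ∀ b k τ → liftSπ b (liftSι k τ) ≈S liftSι k (liftSπ b τ)
  liftSπ-liftSι b k τ = mk≈ (λ _ → refl) (λ n i → sym (liftSπ-nat b τ (liftSι k τ)
    (λ n → subι (liftι n (shiftι k))) (λ n → subι (liftι n (shiftι k)))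
    (λ _ _ → refl) (λ n _ → idbody-lift n (shiftι k) 0) (λ n B → sym (renπ-subι (shiftπ b) _ B)) n i))

  wk-nat : ∀ k m τ F →
    sub (liftSι k (liftSι m τ)) (subι (liftι k (shiftι m)) F) ≡ subι (liftι k (shiftι m)) (sub (liftSι k τ) F)
  wk-nat k m τ F = trans (sub-subι _ _ F) (trans (sub-ext (mk≈ (liftι-shift-comm k m (ind τ)) (λ n i →
    trans (subι-comp _ _ (prd τ n i)) (trans (subι-ext (λ x →
      trans (liftι-comp n _ _ x) (trans (liftι-ext n (λ y → sym (liftι-hi k (shiftι m) y)) x) (sym (liftι-comp n _ _ x))))
      (prd τ n i)) (sym (subι-comp _ _ (prd τ n i)))))) F) (sym (subι-sub _ _ F)))

  wkι-comm : ∀ k τ A → sub (liftSι k τ) (subι (shiftι k) A) ≡ subι (shiftι k) (sub τ A)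
  wkι-comm k τ A = trans (sub-subι _ _ A) (trans (sub-ext (mk≈ (liftι-hi k (ind τ)) (λ n i → refl)) A)
      (sym (subι-sub _ _ A)))

  wkπ-comm : ∀ b τ A → sub (liftSπ b τ) (renπ (shiftπ b) A) ≡ renπ (shiftπ b) (sub τ A)
  wkπ-comm b τ A = trans (sub-renπ _ _ A) (trans
      (sub-ext (mk≈ (λ _ → refl) (λ n i → liftSπ-shifted b τ n i)) A) (sym (renπ-sub _ _ A)))

  -- μBody m D is μ C x̄ D ⟨x̄⟩ as a body: the closure substituted for C in the unfolding of a fixed point.
  μBody : ℕ → Fm → Fm
  μBody m D = μ m (subι (liftι m (shiftι m)) D) (varsFrom m 0)

  μBody-nat : ∀ m τ D → sub (liftSι m τ) (μBody m D) ≡ μBody m (sub (liftSι m (liftSπ m τ)) D)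
  μBody-nat m τ D = cong₂ (μ m)
    (trans (sub-ext (liftSι-ext m (liftSπ-liftSι m m τ)) (subι (liftι m (shiftι m)) D)) (wk-nat m m (liftSπ m τ) D))
    (liftι-vars m (ind τ))

  -- τ undoes the shift by a predicate binder of arity m (as single and σd do); then the
  -- composite acts only through its term part.
  UndoesShift : Subst → ℕ → Set
  UndoesShift τ m = ∀ k l → prd τ k (shiftπ m k l) ≡ idbody k l

  unshiftπ : ∀ n τ m → UndoesShift τ m → ∀ B → sub (liftSι n τ) (renπ (shiftπ m) B) ≡ subι (liftι n (ind τ)) B
  unshiftπ n τ m h B = trans (sub-renπ _ _ B) (trans (sub-ext (mk≈ (λ _ → refl) (λ k l →
    trans (cong (subι (liftι k (shiftι n))) (h k l)) (idbody-lift k _ l))) B) (sym (subι-as-sub _ B)))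

  sub-inst : ∀ {m} σ (ts : Vec Term m) F →
    sub σ (subι (inst ts var) F) ≡ subι (inst (subTs (ind σ) ts) var) (sub (liftSι m σ) F)
  sub-inst {m} σ ts F = trans (sub-subι _ _ F) (trans (sub-ext (mk≈ (inst-lift ts (ind σ))
    (λ n i → sym (unshift (subTs (ind σ) ts) n (prd σ n i)))) F) (sym (subι-sub _ _ F)))

  single-ι : ∀ t A → sub (single ι t) A ≡ subι (inst (t ∷ []) var) A
  single-ι t A = sym (trans (subι-as-sub _ A) (sub-ext (mk≈ (λ _ → refl) (λ _ _ → refl)) A))

  sub-singleι : ∀ σ t A → sub σ (sub (single ι t) A) ≡ sub (single ι (subT (ind σ) t)) (sub (liftSι 1 σ) A)
  sub-singleι σ t A = trans (cong (sub σ) (single-ι t A)) (trans (sub-inst σ (t ∷ []) A) (sym (single-ι _ _)))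

  singleπ-nat : ∀ n τ G → (τ ⊙ single (π n) G) ≈S (single (π n) (sub (liftSι n τ) G) ⊙ liftSπ n τ)
  singleπ-nat n τ G = mk≈ (λ j → sym (subT-id (ind τ j))) bodies
    where
    G' = sub (liftSι n τ) G
    bodies : ∀ k l → sub (liftSι k τ) (replC n G k l) ≡ sub (liftSι k (single (π n) G')) (prd (liftSπ n τ) k l)
    bodies k l with bound-or-shifted n k l
    ... | inj₁ (refl , refl) = trans (cong (sub (liftSι k τ)) (replC-new k G))
          (sym (trans (cong (sub (liftSι k (single (π k) G'))) (prd-liftSπ-new k τ))
            (trans (sub-idbody k (single (π k) G') 0) (replC-new k G'))))
    ... | inj₂ (i , refl) = trans (cong (sub (liftSι k τ)) (replC-shift n G k i))
          (trans (sub-idbody k τ i) (sym (trans (cong (sub (liftSι k (single (π n) G'))) (liftSπ-shifted n τ k i))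
            (trans (unshiftπ k (single (π n) G') n (replC-shift n G') (prd τ k i))
              (trans (subι-ext (liftι-id k) (prd τ k i)) (subι-id (prd τ k i)))))))

  sub-singleπ : ∀ σ n G A → sub σ (sub (single (π n) G) A) ≡ sub (single (π n) (sub (liftSι n σ) G)) (sub (liftSπ n σ) A)
  sub-singleπ σ n G A = trans (sub-comp _ _ A) (trans (sub-ext (singleπ-nat n σ G) A) (sym (sub-comp _ _ A)))

  σd-nat : ∀ m D ts σ → (σ ⊙ σd m D ts) ≈S (σd m (sub (liftSι m (liftSπ m σ)) D) (subTs (ind σ) ts) ⊙ liftSι m (liftSπ m σ))
  σd-nat m D ts σ = mk≈ (inst-lift ts (ind σ)) bodies
    where
    D' = sub (liftSι m (liftSπ m σ)) D
    ts' = subTs (ind σ) ts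
    σd' = σd m D' ts'
    bodies : ∀ k l → sub (liftSι k σ) (replC m (μBody m D) k l) ≡ sub (liftSι k σd')
        (subι (liftι k (shiftι m)) (prd (liftSπ m σ) k l))
    bodies k l with bound-or-shifted m k l
    ... | inj₁ (refl , refl) = trans (cong (sub (liftSι k σ)) (replC-new k (μBody k D))) (trans (μBody-nat k σ D)
          (sym (trans (cong (λ X → sub (liftSι k σd') (subι (liftι k (shiftι k)) X)) (prd-liftSπ-new k σ))
            (trans (cong (sub (liftSι k σd')) (idbody-lift k (shiftι k) 0))
                (trans (sub-idbody k σd' 0) (replC-new k (μBody k D')))))))
    ... | inj₂ (i , refl) = trans (cong (sub (liftSι k σ)) (replC-shift m (μBody m D) k i)) (trans (sub-idbody k σ i)
          (sym (trans (cong (λ X → sub (liftSι k σd') (subι (liftι k (shiftι m)) X)) (liftSπ-shifted m σ k i))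
            (trans (cong (sub (liftSι k σd')) (sym (renπ-subι (shiftπ m) _ (prd σ k i))))
              (trans (unshiftπ k σd' m (replC-shift m (μBody m D')) _) (unshift ts' k (prd σ k i)))))))

  sub-σd : ∀ σ m D ts X →
    sub σ (sub (σd m D ts) X) ≡ sub (σd m (sub (liftSι m (liftSπ m σ)) D) (subTs (ind σ) ts)) (sub (liftSι m (liftSπ m σ)) X)
  sub-σd σ m D ts X = trans (sub-comp _ _ X) (trans (sub-ext (σd-nat m D ts σ) X) (sym (sub-comp _ _ X)))

  σg-nat : ∀ m F σ → (liftSι m σ ⊙ σg m F) ≈S (σg m (sub (liftSι m σ) F) ⊙ liftSι m (liftSπ m σ))
  σg-nat m F σ = ≈trans (⊙-ext {liftSι m σ} {liftSι m σ} {σg m F} {single (π m) Fw} (≈refl {liftSι m σ})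
      (mk≈ (λ _ → refl) (λ _ _ → refl)))
    (≈trans (singleπ-nat m (liftSι m σ) Fw)
      (⊙-ext {single (π m) (sub (liftSι m (liftSι m σ)) Fw)} {σg m (sub (liftSι m σ) F)} {liftSπ m (liftSι m σ)} {liftSι m (liftSπ m σ)}
        (mk≈ (λ _ → refl) (λ k l → cong (λ X → replC m X k l) (wk-nat m m σ F))) (liftSπ-liftSι m m σ)))
    where
    Fw = subι (liftι m (shiftι m)) F

  sub-σg : ∀ σ m F D → sub (liftSι m σ) (sub (σg m F) D) ≡ sub (σg m (sub (liftSι m σ) F)) (sub (liftSι m (liftSπ m σ)) D)
  sub-σg σ m F D = trans (sub-comp _ _ D) (trans (sub-ext (σg-nat m F σ) D) (sym (sub-comp _ _ D)))

  WFS-replC : ∀ m X → WF X → ∀ n i → WF (replC m X n i)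
  WFS-replC m X w n zero with n ≡ᵇ m
  ... | true = w
  ... | false = pvar
  WFS-replC m X w n (suc i) with n ≡ᵇ m
  ... | true = pvar
  ... | false = pvar

  WFS-singleι : ∀ t → WFS (single ι t)
  WFS-singleι t n i = pvar

  WF-μBody : ∀ m D ts → WF (μ m D ts) → WF (μBody m D)
  WF-μBody m D ts (μ w o p) = μ (WF-subι _ D w) (Occ-subι _ D o) (Pl-subι pos _ D p)

  WFS-σd : ∀ m D ts → WF (μ m D ts) → WFS (σd m D ts)
  WFS-σd m D ts w = WFS-replC m (μBody m D) (WF-μBody m D ts w)

  -- Instantiating a weakened binder by its own variable is the identity; this gives the
  -- congruence of ⊆ under quantifiers.
  inst-var0 : ∀ X → sub (single ι (var 0)) (subι (liftι 1 (shiftι 1)) X) ≡ X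
  inst-var0 X = trans (single-ι (var 0) _) (trans (subι-comp _ _ X) (trans (subι-ext pw X) (subι-id X)))
    where
    pw : (inst (var 0 ∷ []) var ⊚ liftι 1 (shiftι 1)) ≐ var
    pw zero = refl
    pw (suc j) = refl

  inst-pvar0 : ∀ b X → sub (single (π b) (idbody b 0)) (renπ (liftπ b (shiftπ b)) X) ≡ X
  inst-pvar0 b X = trans (sub-renπ _ _ X) (trans (sub-ext (mk≈ (λ _ → refl) bodies) X) (sub-id X))
    where
    bodies : ∀ n i → replC b (idbody b 0) n (liftπ b (shiftπ b) n i) ≡ idbody n i
    bodies n i with bound-or-shifted b n i
    ... | inj₁ (refl , refl) = trans (cong (replC n (idbody n 0) n) (liftπ-new n (shiftπ n))) (replC-new n (idbody n 0))
    ... | inj₂ (i' , refl) = trans (cong (replC b (idbody b 0) n) (liftπ-shift b (shiftπ b) n i'))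
          (trans (replC-shift b (idbody b 0) n (shiftπ b n i')) refl)

  inst-μBody : ∀ {b} (us : Vec Term b) X → subι (inst us var) (μBody b X) ≡ μ b X us
  inst-μBody {b} us X = cong₂ (μ b) (unshift us b X) (inst-vars us var)

  μBody-shift : ∀ b X → μBody b (subι (liftι b (shiftι b)) X) ≡ subι (liftι b (shiftι b)) (μBody b X)
  μBody-shift b X = cong₂ (μ b) (trans (subι-comp _ _ X) (trans (subι-ext (λ j →
      trans (liftι-comp b _ _ j) (trans (liftι-ext b (λ y → sym (liftι-hi b (shiftι b) y)) j) (sym (liftι-comp b _ _ j)))) X)
      (sym (subι-comp _ _ X))))
    (sym (liftι-vars b (shiftι b)))

  σg-μBody : ∀ b X →
    sub (σg b (μBody b X)) X ≡ sub (σd b (subι (liftι b (shiftι b)) X) (varsFrom b 0)) (subι (liftι b (shiftι b)) X)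
  σg-μBody b X = sym (trans (sub-subι _ _ X) (sub-ext (mk≈ (vars-unshift b)
    (λ n i → cong (λ Z → replC b Z n i) (μBody-shift b X))) X))

  WF-μ-args : ∀ {m D ts ts'} → WF (μ m D ts) → WF (μ m D ts')
  WF-μ-args (μ a b c) = μ a b c

  WF-μ-body : ∀ {m D ts} → WF (μ m D ts) → WF D
  WF-μ-body (μ w _ _) = w

  WF-μ-pos : ∀ {m D ts} → WF (μ m D ts) → Pos m 0 D
  WF-μ-pos (μ _ _ p) = p

  Agree-single : ∀ n G G' → Agree (single (π n) G) (single (π n) G') n 0
  Agree-single n G G' = mkAg (λ _ → refl) (replC-others n G G')

  σd-split : ∀ m D ts → σd m D ts ≈S (ιS (inst ts var) ⊙ σg m (μBody m D))
  σd-split m D ts = mk≈ (λ _ → refl) bodies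
    where
    Mu = μBody m D
    bodies : ∀ n i → replC m Mu n i ≡ sub (liftSι n (ιS (inst ts var))) (replC m (subι (liftι m (shiftι m)) Mu) n i)
    bodies n i with bound-or-shifted m n i
    ... | inj₁ (refl , refl) = trans (replC-new n Mu) (sym (trans (cong (sub (liftSι n (ιS (inst ts var)))) (replC-new n _))
          (trans (sub-liftιS n _ _) (unshift ts n Mu))))
    ... | inj₂ (i' , refl) = trans (replC-shift m Mu n i')
        (sym (trans (cong (sub (liftSι n (ιS (inst ts var)))) (replC-shift m _ n i'))
          (sub-idbody n (ιS (inst ts var)) i')))

  σd-via-σg : ∀ m D ts X → sub (σd m D ts) X ≡ sub (ιS (inst ts var)) (sub (σg m (μBody m D)) X)
  σd-via-σg m D ts X = trans (sub-ext (σd-split m D ts) X) (sym (sub-comp _ _ X))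

module ArrowTypes (S : Signature) where
  open Syntax S
  open Substitution S
  open Polarity S
  open FixedPointSubstitutions S

  AT-subι : ∀ ρ {A} → ArrowType A → ArrowType (subι ρ A)
  AT-subι ρ (A ⇒ B) = _ ⇒ _
  AT-subι ρ (∀ι a) = ∀ι (AT-subι _ a)
  AT-subι ρ (∀π a) = ∀π (AT-subι _ a)
  AT-subι ρ (μ a) = μ (AT-subι _ a)

  AT-subι⁻ : ∀ ρ A → ArrowType (subι ρ A) → ArrowType A
  AT-subι⁻ ρ (A ⇒ B) a = A ⇒ B
  AT-subι⁻ ρ (∀ι A) (∀ι a) = ∀ι (AT-subι⁻ _ A a)
  AT-subι⁻ ρ (∀π n A) (∀π a) = ∀π (AT-subι⁻ _ A a)
  AT-subι⁻ ρ (μ m D ts) (μ a) = μ (AT-subι⁻ _ D a)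

  AT-renπ : ∀ r {A} → ArrowType A → ArrowType (renπ r A)
  AT-renπ r (A ⇒ B) = _ ⇒ _
  AT-renπ r (∀ι a) = ∀ι (AT-renπ _ a)
  AT-renπ r (∀π a) = ∀π (AT-renπ _ a)
  AT-renπ r (μ a) = μ (AT-renπ _ a)

  AT-renπ⁻ : ∀ r A → ArrowType (renπ r A) → ArrowType A
  AT-renπ⁻ r (A ⇒ B) a = A ⇒ B
  AT-renπ⁻ r (∀ι A) (∀ι a) = ∀ι (AT-renπ⁻ _ A a)
  AT-renπ⁻ r (∀π n A) (∀π a) = ∀π (AT-renπ⁻ _ A a)
  AT-renπ⁻ r (μ m D ts) (μ a) = μ (AT-renπ⁻ _ D a)

  AT-sub : ∀ σ {A} → ArrowType A → ArrowType (sub σ A)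
  AT-sub σ (A ⇒ B) = _ ⇒ _
  AT-sub σ (∀ι a) = ∀ι (AT-sub _ a)
  AT-sub σ (∀π a) = ∀π (AT-sub _ a)
  AT-sub σ (μ a) = μ (AT-sub _ a)

  NonAT : Subst → Set
  NonAT σ = ∀ n i → ¬ ArrowType (prd σ n i)

  NonAT-liftSι : ∀ k σ → NonAT σ → NonAT (liftSι k σ)
  NonAT-liftSι k σ h n i a = h n i (AT-subι⁻ _ (prd σ n i) a)

  AT-idbody : ∀ n i → ¬ ArrowType (idbody n i)
  AT-idbody n i ()

  NonAT-liftSπ : ∀ b σ → NonAT σ → NonAT (liftSπ b σ)
  NonAT-liftSπ b σ h n j a with bound-or-shifted b n j
  ... | inj₁ (refl , refl) = AT-idbody b 0 (subst ArrowType (prd-liftSπ-new b σ) a)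
  ... | inj₂ (i , refl) = h n i (AT-renπ⁻ _ (prd σ n i) (subst ArrowType (liftSπ-shifted b σ n i) a))

  AT-sub⁻ : ∀ σ A → NonAT σ → ArrowType (sub σ A) → ArrowType A
  AT-sub⁻ σ (pvar n i ts) h a = ⊥-elim (h n i (AT-subι⁻ _ (prd σ n i) a))
  AT-sub⁻ σ (A ⇒ B) h a = A ⇒ B
  AT-sub⁻ σ (∀ι A) h (∀ι a) = ∀ι (AT-sub⁻ _ A (NonAT-liftSι 1 σ h) a)
  AT-sub⁻ σ (∀π n A) h (∀π a) = ∀π (AT-sub⁻ _ A (NonAT-liftSπ n σ h) a)
  AT-sub⁻ σ (μ m D ts) h (μ a) = μ (AT-sub⁻ _ D (NonAT-liftSι m (liftSπ m σ) (NonAT-liftSπ m σ h)) a)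

  AT? : ∀ A → Dec (ArrowType A)
  AT? ⊥' = no λ ()
  AT? (pvar n i ts) = no λ ()
  AT? (pcon P ts) = no λ ()
  AT? (A ⇒ B) = yes (A ⇒ B)
  AT? (∀ι A) with AT? A
  ... | yes a = yes (∀ι a)
  ... | no na = no λ { (∀ι a) → na a }
  AT? (∀π n A) with AT? A
  ... | yes a = yes (∀π a)
  ... | no na = no λ { (∀π a) → na a }
  AT? (μ m D ts) with AT? D
  ... | yes a = yes (μ a)
  ... | no na = no λ { (μ a) → na a }

  NonAT-σd : ∀ m D ts → ¬ ArrowType D → NonAT (σd m D ts)
  NonAT-σd m D ts na n zero a with n ≡ᵇ m
  NonAT-σd m D ts na n zero (μ a) | true = na (AT-subι⁻ _ D a)
  NonAT-σd m D ts na n zero () | false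
  NonAT-σd m D ts na n (suc i) a with n ≡ᵇ m
  NonAT-σd m D ts na n (suc i) () | true
  NonAT-σd m D ts na n (suc i) () | false

  AT-unfold⁻ : ∀ m D ts → ArrowType (sub (σd m D ts) D) → ArrowType D
  AT-unfold⁻ m D ts a with AT? D
  ... | yes aD = aD
  ... | no ¬aD = ⊥-elim (¬aD (AT-sub⁻ _ D (NonAT-σd m D ts ¬aD) a))

  sub-∀* : ∀ σ vs M → sub σ (∀* vs M) ≡ ∀* vs (sub (lift* vs σ) M)
  sub-∀* σ [] M = refl
  sub-∀* σ (ι ∷ ks) M = cong ∀ι (sub-∀* _ ks M)
  sub-∀* σ (π n ∷ ks) M = cong (∀π n) (sub-∀* _ ks M)

  ∀*-inj : ∀ vs vs' G D G' D' → ∀* vs (G ⇒ D) ≡ ∀* vs' (G' ⇒ D') → (vs ≡ vs') × (G ≡ G') × (D ≡ D')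
  ∀*-inj [] [] G D .G .D refl = refl , refl , refl
  ∀*-inj [] (ι ∷ vs') G D G' D' ()
  ∀*-inj [] (π x ∷ vs') G D G' D' ()
  ∀*-inj (ι ∷ vs) [] G D G' D' ()
  ∀*-inj (π x ∷ vs) [] G D G' D' ()
  ∀*-inj (ι ∷ vs) (ι ∷ vs') G D G' D' e with ∀*-inj vs vs' G D G' D' (∀ι-inj e)
    where
    ∀ι-inj : ∀ {X Y} → ∀ι X ≡ ∀ι Y → X ≡ Y
    ∀ι-inj refl = refl
  ... | refl , b , c = refl , b , c
  ∀*-inj (ι ∷ vs) (π x ∷ vs') G D G' D' ()
  ∀*-inj (π x ∷ vs) (ι ∷ vs') G D G' D' ()
  ∀*-inj (π x ∷ vs) (π y ∷ vs') G D G' D' e with ∀π-inj e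
    where
    ∀π-inj : ∀ {X Y a b} → ∀π a X ≡ ∀π b Y → (a ≡ b) × (X ≡ Y)
    ∀π-inj refl = refl , refl
  ... | refl , e' with ∀*-inj vs vs' G D G' D' e'
  ... | refl , b , c = refl , b , c

  shape-sub : ∀ σ vs {X} G D → X ≡ ∀* vs (G ⇒ D) → sub σ X ≡ ∀* vs (sub (lift* vs σ) G ⇒ sub (lift* vs σ) D)
  shape-sub σ vs G D e = trans (cong (sub σ) e) (sub-∀* σ vs (G ⇒ D))

  RepShape : Fm → Set
  RepShape A = Σ (List Kind) λ vs → Σ Fm λ G → Σ Fm λ D → Rep A ≡ ∀* vs (G ⇒ D)

  rep-shape : ∀ {A} → ArrowType A → RepShape A
  rep-shape (A ⇒ B) = [] , A , B , refl
  rep-shape (∀ι a) with rep-shape a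
  ... | vs , G , D , e = ι ∷ vs , G , D , cong ∀ι e
  rep-shape (∀π {n} a) with rep-shape a
  ... | vs , G , D , e = π n ∷ vs , G , D , cong (∀π n) e
  rep-shape (μ {m} {D₀} {ts} a) with rep-shape a
  ... | vs , G , D , e = vs , sub (lift* vs (σd m D₀ ts)) G , sub (lift* vs (σd m D₀ ts)) D , shape-sub (σd m D₀ ts) vs G D e

  Rep-sub : ∀ σ {A} → ArrowType A → Rep (sub σ A) ≡ sub σ (Rep A)
  Rep-sub σ (A ⇒ B) = refl
  Rep-sub σ (∀ι a) = cong ∀ι (Rep-sub _ a)
  Rep-sub σ (∀π a) = cong (∀π _) (Rep-sub _ a)
  Rep-sub σ (μ {m} {D} {ts} a) = trans (cong (sub _) (Rep-sub _ a)) (sym (sub-σd σ m D ts (Rep D)))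

  -- Rep preserves polarity: its unfoldings substitute closures in which the variable keeps its polarity.
  Pl-Rep : ∀ p {m k} A → WF A → ArrowType A → Pl p m k A → Pl p m k (Rep A)
  Pl-Rep p (A ⇒ B) w a h = h
  Pl-Rep p (∀ι A) (∀ι w) (∀ι a) h = mkPl∀ι p (Pl-Rep p A w a (Pl∀ι p h))
  Pl-Rep p (∀π n A) (∀π w) (∀π a) h = mkPl∀π p (Pl-Rep p A w a (Pl∀π p h))
  Pl-Rep p {m} {k} (μ b D ts) (μ w o pD) (μ a) h = Pl-sub p (σd b D ts) (Rep D) cls
    where
    pol-Rep-D : Pl p m (shiftπ b m k) (Rep D)
    pol-Rep-D = Pl-Rep p D w a (Plμ p h)
    pos-Rep-D : Pos b 0 (Rep D)
    pos-Rep-D = Pl-Rep pos D w a pD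
    pol-closure : Pl p m k (μBody b D)
    pol-closure = mkPlμ p (Pl-subι p _ D (Plμ p h))
    cls : Classified p m k (σd b D ts) (PosOf (Rep D)) (NegOf (Rep D))
    cls .classify n j with bound-or-shifted b n j
    ... | inj₁ (refl , refl) = inj₁ (pos-Rep-D , subst (Pl p m k) (sym (replC-new n (μBody n D))) pol-closure)
    ... | inj₂ (i , refl) with n ≟ m | i ≟ k
    ...   | yes refl | yes refl = positive-entry p pol-Rep-D (subst (Pos m k) (sym (replC-shift b (μBody b D) m k)) pvar)
    ...   | no ne | _ = inj₂ (inj₂ (λ o → ne (proj₁ (occ-pvar (subst (Occurs m k) (replC-shift b (μBody b D) n i) o)))))
    ...   | yes refl | no ne = inj₂ (inj₂
        (λ o → ne (proj₂ (occ-pvar (subst (Occurs m k) (replC-shift b (μBody b D) n i) o)))))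

  WF-Rep : ∀ {A} → WF A → ArrowType A → WF (Rep A)
  WF-Rep w (A ⇒ B) = w
  WF-Rep (∀ι w) (∀ι a) = ∀ι (WF-Rep w a)
  WF-Rep (∀π w) (∀π a) = ∀π (WF-Rep w a)
  WF-Rep {μ m D ts} (μ wD o p) (μ a) = WF-sub (σd m D ts) (WFS-σd m D ts (μ wD o p)) (Rep D) (WF-Rep wD a)

  Rep-sub-shape : ∀ σ {A} → ArrowType A → ∀ vs G D → Rep A ≡ ∀* vs (G ⇒ D) →
    Rep (sub σ A) ≡ ∀* vs (sub (lift* vs σ) G ⇒ sub (lift* vs σ) D)
  Rep-sub-shape σ at vs G D e = trans (Rep-sub σ at) (shape-sub σ vs G D e)

  Rep-∀K : ∀ k A → Rep (∀K k A) ≡ ∀K k (Rep A)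
  Rep-∀K ι A = refl
  Rep-∀K (π n) A = refl

  Rep-μ-shape : ∀ m D ts vs Dg Dd → Rep D ≡ ∀* vs (Dg ⇒ Dd) →
    Rep (μ m D ts) ≡ ∀* vs (sub (lift* vs (ιS (inst ts var))) (sub (lift* vs (σg m (μBody m D))) Dg)
                          ⇒ sub (lift* vs (ιS (inst ts var))) (sub (lift* vs (σg m (μBody m D))) Dd))
  Rep-μ-shape m D ts vs Dg Dd e =
    trans (σd-via-σg m D ts (Rep D)) (shape-sub (ιS (inst ts var)) vs _ _ (shape-sub (σg m (μBody m D)) vs Dg Dd e))

  WF-Rep-parts : ∀ {A} vs G D → WF A → ArrowType A → Rep A ≡ ∀* vs (G ⇒ D) → WF G × WF D
  WF-Rep-parts vs G D w at e = WF-∀*⇒ vs (subst WF e (WF-Rep w at))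

  Pos-Rep-parts : ∀ {m k A} vs G D → WF A → ArrowType A → Pos m k A → Rep A ≡ ∀* vs (G ⇒ D) →
    Neg m (shiftK vs m k) G × Pos m (shiftK vs m k) D
  Pos-Rep-parts {m} {k} {A} vs G D w at p e = Pos⇒ (Pl-∀* pos vs (subst (Pos m k) e (Pl-Rep pos A w at p)))

module Instantiation (S : Signature) where
  open Syntax S
  open Substitution S
  open Polarity S
  open FixedPointSubstitutions S

  extS : (k : Kind) → Subst → Item k → Subst
  ind (extS ι σ t) zero = t
  ind (extS ι σ t) (suc j) = ind σ j
  prd (extS ι σ t) = prd σ
  ind (extS (π n) σ G) = ind σ
  prd (extS (π n) σ G) m zero = if m ≡ᵇ n then G else prd σ m zero
  prd (extS (π n) σ G) m (suc i) = if m ≡ᵇ n then prd σ m i else prd σ m (suc i)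

  extS-new : ∀ n σ G → prd (extS (π n) σ G) n 0 ≡ G
  extS-new n σ G rewrite ≡ᵇ-refl n = refl

  extS-shift : ∀ n σ G m i → prd (extS (π n) σ G) m (shiftπ n m i) ≡ prd σ m i
  extS-shift n σ G m zero with m ≡ᵇ n in eq
  ... | true rewrite eq = refl
  ... | false rewrite eq = refl
  extS-shift n σ G m (suc i) with m ≡ᵇ n in eq
  ... | true rewrite eq = refl
  ... | false rewrite eq = refl

  actItem : (k : Kind) → Subst → Item k → Item k
  actItem ι τ t = subT (ind τ) t
  actItem (π n) τ G = sub (liftSι n τ) G

  extS-ext : ∀ k {σ σ'} g → σ ≈S σ' → extS k σ g ≈S extS k σ' g
  extS-ext ι g (mk≈ a b) = mk≈ (λ { zero → refl ; (suc j) → a j }) b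
  extS-ext (π n) g (mk≈ a b) = mk≈ a (λ { m zero → cong (if m ≡ᵇ n then g else_) (b m 0)
    ; m (suc i) → cong₂ (if m ≡ᵇ n then_else_) (b m i) (b m (suc i)) })

  single-extS : ∀ k g → single k g ≈S extS k idS g
  single-extS ι t = mk≈ (λ { zero → refl ; (suc j) → refl }) (λ _ _ → refl)
  single-extS (π n) G = mk≈ (λ _ → refl) (λ { m zero → refl ; m (suc i) → refl })

  ⊙-extS : ∀ k τ σ g → (τ ⊙ extS k σ g) ≈S extS k (τ ⊙ σ) (actItem k τ g)
  ⊙-extS ι τ σ t = mk≈ (λ { zero → refl ; (suc j) → refl }) (λ _ _ → refl)
  ⊙-extS (π n) τ σ G = mk≈ (λ _ → refl) bodies
    where
    bodies : ∀ m j → sub (liftSι m τ) (prd (extS (π n) σ G) m j) ≡ prd (extS (π n) (τ ⊙ σ) (sub (liftSι n τ) G)) m j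
    bodies m j with bound-or-shifted n m j
    ... | inj₁ (refl , refl) = trans (cong (sub (liftSι m τ)) (extS-new m σ G)) (sym (extS-new m (τ ⊙ σ) _))
    ... | inj₂ (i , refl) = trans (cong (sub (liftSι m τ)) (extS-shift n σ G m i)) (sym (extS-shift n (τ ⊙ σ) _ m i))

  liftK-ext : ∀ k {σ τ} → σ ≈S τ → liftK k σ ≈S liftK k τ
  liftK-ext ι e = liftSι-ext 1 e
  liftK-ext (π n) e = liftSπ-ext n e

  liftK-⊙ : ∀ k σ τ → (liftK k σ ⊙ liftK k τ) ≈S liftK k (σ ⊙ τ)
  liftK-⊙ ι σ τ = liftSι-⊙ 1 σ τ
  liftK-⊙ (π n) σ τ = liftSπ-⊙ n σ τ

  lift*-ext : ∀ vs {σ τ} → σ ≈S τ → lift* vs σ ≈S lift* vs τ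
  lift*-ext [] e = e
  lift*-ext (k ∷ ks) e = lift*-ext ks (liftK-ext k e)

  lift*-⊙ : ∀ vs σ τ → (lift* vs σ ⊙ lift* vs τ) ≈S lift* vs (σ ⊙ τ)
  lift*-⊙ [] σ τ = ≈refl
  lift*-⊙ (k ∷ ks) σ τ = ≈trans (lift*-⊙ ks (liftK k σ) (liftK k τ)) (lift*-ext ks (liftK-⊙ k σ τ))

  extS-liftK : ∀ k σ g υ → (extS k σ g ⊙ liftK k υ) ≈S extS k (σ ⊙ υ) g
  extS-liftK ι σ t υ = mk≈ (λ { zero → refl ; (suc j) → wk1-sub (ind (extS ι σ t)) (ind υ j) })
    (λ n i → trans (sub-subι _ _ (prd υ n i)) (sub-ext (mk≈
      (λ j → trans (liftι-comp n _ _ j) (liftι-ext n (λ _ → refl) j)) (λ _ _ → refl)) (prd υ n i)))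
  extS-liftK (π b) σ G υ = mk≈ (λ _ → refl) bodies
    where
    bodies : ∀ m j → sub (liftSι m (extS (π b) σ G)) (prd (liftSπ b υ) m j) ≡ prd (extS (π b) (σ ⊙ υ) G) m j
    bodies m j with bound-or-shifted b m j
    ... | inj₁ (refl , refl) = trans (cong (sub (liftSι m (extS (π m) σ G))) (prd-liftSπ-new m υ))
          (trans (sub-idbody m (extS (π m) σ G) 0) (trans (extS-new m σ G) (sym (extS-new m (σ ⊙ υ) G))))
    ... | inj₂ (i , refl) = trans (cong (sub (liftSι m (extS (π b) σ G))) (liftSπ-shifted b υ m i))
          (trans (sub-renπ _ _ (prd υ m i)) (trans (sub-ext (mk≈ (λ _ → refl)
            (λ k l → cong (subι (liftι k (shiftι m))) (extS-shift b σ G k l))) (prd υ m i))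
            (sym (extS-shift b (σ ⊙ υ) G m i))))

  single-liftK : ∀ k g σ → (single k g ⊙ liftK k σ) ≈S extS k σ g
  single-liftK k g σ = ≈trans (⊙-ext {single k g} {extS k idS g} {liftK k σ} {liftK k σ} (single-extS k g) ≈refl)
    (≈trans (extS-liftK k idS g σ) (extS-ext k g (⊙-idl σ)))

  ⊙-single : ∀ k τ g → (τ ⊙ single k g) ≈S extS k τ (actItem k τ g)
  ⊙-single k τ g = ≈trans (⊙-ext {τ} {τ} {single k g} {extS k idS g} ≈refl (single-extS k g))
    (≈trans (⊙-extS k τ idS g) (extS-ext k _ (⊙-idr τ)))

  -- instS vs σ G instantiates the prefix vs by G on top of σ; instSeq (from Defs) computes the same
  -- substitution one variable at a time.
  instS : (vs : List Kind) → Subst → All Item vs → Subst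
  instS [] σ [] = σ
  instS (k ∷ ks) σ (g ∷ gs) = instS ks (extS k σ g) gs

  instS-ext : ∀ vs {σ σ'} G → σ ≈S σ' → instS vs σ G ≈S instS vs σ' G
  instS-ext [] [] e = e
  instS-ext (k ∷ ks) (g ∷ gs) e = instS-ext ks gs (extS-ext k g e)

  instSeq-instS : ∀ vs σ G M → instSeq vs G (sub (lift* vs σ) M) ≡ sub (instS vs σ G) M
  instSeq-instS [] σ [] M = refl
  instSeq-instS (k ∷ ks) σ (g ∷ gs) M =
    trans (cong (instSeq ks gs) (trans (sub-comp _ _ M) (sub-ext (≈trans (lift*-⊙ ks (single k g) (liftK k σ))
      (lift*-ext ks (single-liftK k g σ))) M)))
    (instSeq-instS ks (extS k σ g) gs M)

  seqS : (vs vs' : List Kind) → All Item vs → Subst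
  seqS vs vs' G = instS vs (weakS vs') G

  substSeq-seqS : ∀ vs vs' G M → substSeq vs vs' G M ≡ sub (seqS vs vs' G) M
  substSeq-seqS vs vs' G M = instSeq-instS vs (weakS vs') G M

  mapItems : Subst → (vs : List Kind) → All Item vs → All Item vs
  mapItems τ [] [] = []
  mapItems τ (k ∷ ks) (g ∷ gs) = actItem k τ g ∷ mapItems τ ks gs

  instS-⊙ : ∀ vs τ σ G → (τ ⊙ instS vs σ G) ≈S instS vs (τ ⊙ σ) (mapItems τ vs G)
  instS-⊙ [] τ σ [] = ≈refl
  instS-⊙ (k ∷ ks) τ σ (g ∷ gs) = ≈trans (instS-⊙ ks τ (extS k σ g) gs) (instS-ext ks _ (⊙-extS k τ σ g))

  instS-lift : ∀ vs σ G υ → (instS vs σ G ⊙ lift* vs υ) ≈S instS vs (σ ⊙ υ) G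
  instS-lift [] σ [] υ = ≈refl
  instS-lift (k ∷ ks) σ (g ∷ gs) υ = ≈trans (instS-lift ks (extS k σ g) gs (liftK k υ))
      (instS-ext ks gs (extS-liftK k σ g υ))

  weakK : Kind → Subst
  weakK ι = ιS (shiftι 1)
  weakK (π n) = πS (shiftπ n)

  weakS-cons : ∀ k ks → weakS (k ∷ ks) ≈S (weakS ks ⊙ weakK k)
  weakS-cons ι ks = mk≈ (λ j → cong var (sym (+-suc (cntι ks) j))) (λ n i → sym (sub-idbody n (weakS ks) i))
  weakS-cons (π b) ks = mk≈ (λ j → refl) (λ n i → sym (trans (sub-idbody n (weakS ks) (shiftπ b n i)) (index-eq n i)))
    where
    index-eq : ∀ n i → idbody n (cntπ n ks + shiftπ b n i) ≡ idbody n (cntπ n (π b ∷ ks) + i)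
    index-eq n i with n ≡ᵇ b
    ... | true = cong (idbody n) (+-suc (cntπ n ks) i)
    ... | false = refl

  weakS-nil : weakS [] ≈S idS
  weakS-nil = mk≈ (λ _ → refl) (λ _ _ → refl)

  extS-weakK : ∀ k σ g → (extS k σ g ⊙ weakK k) ≈S σ
  extS-weakK ι σ t = mk≈ (λ _ → refl) (λ n i → sub-idbody n (extS ι σ t) i)
  extS-weakK (π b) σ G = mk≈ (λ _ → refl) (λ n i → trans (sub-idbody n (extS (π b) σ G) (shiftπ b n i))
      (extS-shift b σ G n i))

  instS-weak : ∀ vs σ G → (instS vs σ G ⊙ weakS vs) ≈S σ
  instS-weak [] σ [] = ⊙-idr σ
  instS-weak (k ∷ ks) σ (g ∷ gs) =
    ≈trans (⊙-ext {instS ks (extS k σ g) gs} {instS ks (extS k σ g) gs} ≈refl (weakS-cons k ks))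
    (≈trans (≈sym (⊙-assoc (instS ks (extS k σ g) gs) (weakS ks) (weakK k)))
    (≈trans (⊙-ext {instS ks (extS k σ g) gs ⊙ weakS ks} {extS k σ g} {weakK k} (instS-weak ks (extS k σ g) gs) ≈refl)
    (extS-weakK k σ g)))

  -- The variable bound by the outermost quantifier of k ∷ ks, seen below the whole prefix.
  headItem : ∀ (k : Kind) (ks : List Kind) → Item k
  headItem ι ks = var (cntι ks)
  headItem (π n) ks = idbody n (cntπ n ks)

  extS-weak-id : ∀ (k : Kind) (ks : List Kind) → extS k (weakS (k ∷ ks)) (headItem k ks) ≈S weakS ks
  extS-weak-id ι ks = mk≈
      (λ { zero → cong var (sym (+-identityʳ (cntι ks))) ; (suc j) → cong var (sym (+-suc (cntι ks) j)) }) (λ _ _ → refl)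
  extS-weak-id (π b) ks = mk≈ (λ _ → refl) bodies
    where
    bodies : ∀ n j → prd (extS (π b) (weakS (π b ∷ ks)) (idbody b (cntπ b ks))) n j ≡ idbody n (cntπ n ks + j)
    bodies n j with bound-or-shifted b n j
    ... | inj₁ (refl , refl) = trans (extS-new n (weakS (π n ∷ ks)) (idbody n (cntπ n ks)))
        (cong (idbody n) (sym (+-identityʳ (cntπ n ks))))
    ... | inj₂ (i , refl) = trans (extS-shift b _ _ n i)
        (trans (≈p (weakS-cons (π b) ks) n i) (sub-idbody n (weakS ks) (shiftπ b n i)))

  idItems : (vs : List Kind) → All Item vs
  idItems [] = []
  idItems (k ∷ ks) = headItem k ks ∷ idItems ks

  seqS-id : ∀ vs → instS vs (weakS vs) (idItems vs) ≈S idS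
  seqS-id [] = weakS-nil
  seqS-id (k ∷ ks) = ≈trans (instS-ext ks (idItems ks) (extS-weak-id k ks)) (seqS-id ks)

  liftK-weakK : ∀ k τ → (liftK k τ ⊙ weakK k) ≈S (weakK k ⊙ τ)
  liftK-weakK ι τ = mk≈ (λ j → refl) (λ n i → trans (sub-idbody n (liftSι 1 τ) i)
      (sym (sub-liftιS n (shiftι 1) (prd τ n i))))
  liftK-weakK (π b) τ = mk≈ (λ j → sym (subT-id (ind τ j)))
    (λ n i → trans (sub-idbody n (liftSπ b τ) (shiftπ b n i))
        (trans (liftSπ-shifted b τ n i) (sym (sub-liftπS n (shiftπ b) (prd τ n i)))))

  weak-nat : ∀ vs τ → (lift* vs τ ⊙ weakS vs) ≈S (weakS vs ⊙ τ)
  weak-nat [] τ = ≈trans (⊙-ext {τ} {τ} {weakS []} {idS} ≈refl weakS-nil) (≈trans (⊙-idr τ) (≈trans (≈sym (⊙-idl τ))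
    (⊙-ext {idS} {weakS []} {τ} {τ} (≈sym weakS-nil) ≈refl)))
  weak-nat (k ∷ ks) τ =
    ≈trans (⊙-ext {L} {L} ≈refl (weakS-cons k ks))
    (≈trans (≈sym (⊙-assoc L (weakS ks) (weakK k)))
    (≈trans (⊙-ext {L ⊙ weakS ks} {weakS ks ⊙ liftK k τ} {weakK k} {weakK k} (weak-nat ks (liftK k τ)) ≈refl)
    (≈trans (⊙-assoc (weakS ks) (liftK k τ) (weakK k))
    (≈trans (⊙-ext {weakS ks} {weakS ks} {liftK k τ ⊙ weakK k} {weakK k ⊙ τ} ≈refl (liftK-weakK k τ))
    (≈trans (≈sym (⊙-assoc (weakS ks) (weakK k) τ))
    (⊙-ext {weakS ks ⊙ weakK k} {weakS (k ∷ ks)} {τ} {τ} (≈sym (weakS-cons k ks)) ≈refl))))))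
    where
    L = lift* ks (liftK k τ)

  WFS-extS : ∀ k σ g → WFS σ → WFItem k g → WFS (extS k σ g)
  WFS-extS ι σ t h _ = h
  WFS-extS (π n) σ G h w m j with bound-or-shifted n m j
  ... | inj₁ (refl , refl) = subst WF (sym (extS-new m σ G)) w
  ... | inj₂ (i , refl) = subst WF (sym (extS-shift n σ G m i)) (h m i)

  WFS-instS : ∀ vs σ G → WFS σ → WFSeq vs G → WFS (instS vs σ G)
  WFS-instS [] σ [] h _ = h
  WFS-instS (k ∷ ks) σ (g ∷ gs) h (w , ws) = WFS-instS ks (extS k σ g) gs (WFS-extS k σ g h w) ws

  WFS-weakS : ∀ vs → WFS (weakS vs)
  WFS-weakS vs n i = pvar

  WFS-liftK : ∀ k σ → WFS σ → WFS (liftK k σ)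
  WFS-liftK ι σ h = WFS-liftSι 1 σ h
  WFS-liftK (π n) σ h = WFS-liftSπ n σ h

  WFS-lift* : ∀ vs σ → WFS σ → WFS (lift* vs σ)
  WFS-lift* [] σ h = h
  WFS-lift* (k ∷ ks) σ h = WFS-lift* ks (liftK k σ) (WFS-liftK k σ h)

  WFItem-actItem : ∀ k τ g → WFS τ → WFItem k g → WFItem k (actItem k τ g)
  WFItem-actItem ι τ t h _ = tt
  WFItem-actItem (π n) τ G h w = WF-sub (liftSι n τ) (WFS-liftSι n τ h) G w

  WFSeq-mapItems : ∀ τ vs G → WFS τ → WFSeq vs G → WFSeq vs (mapItems τ vs G)
  WFSeq-mapItems τ [] [] h _ = tt
  WFSeq-mapItems τ (k ∷ ks) (g ∷ gs) h (w , ws) = WFItem-actItem k τ g h w , WFSeq-mapItems τ ks gs h ws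

  WFSeq-idItems : ∀ vs → WFSeq vs (idItems vs)
  WFSeq-idItems [] = tt
  WFSeq-idItems (ι ∷ ks) = tt , WFSeq-idItems ks
  WFSeq-idItems (π n ∷ ks) = pvar , WFSeq-idItems ks

  WFS-single : ∀ k g → WFItem k g → WFS (single k g)
  WFS-single ι t _ n i = pvar
  WFS-single (π n) G w m j with bound-or-shifted n m j
  ... | inj₁ (refl , refl) = subst WF (sym (replC-new m G)) w
  ... | inj₂ (i , refl) = subst WF (sym (replC-shift n G m i)) pvar

  WFS-weakK : ∀ k → WFS (weakK k)
  WFS-weakK ι n i = pvar
  WFS-weakK (π b) n i = pvar

  actItem-comp : ∀ k τ υ g → actItem k τ (actItem k υ g) ≡ actItem k (τ ⊙ υ) g
  actItem-comp ι τ υ t = subT-comp (ind τ) (ind υ) t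
  actItem-comp (π n) τ υ G = trans (sub-comp _ _ G) (sub-ext (liftSι-⊙ n τ υ) G)

  actItem-ext : ∀ k {τ τ'} g → τ ≈S τ' → actItem k τ g ≡ actItem k τ' g
  actItem-ext ι t e = subT-ext (≈i e) t
  actItem-ext (π n) G e = sub-ext (liftSι-ext n e) G

  actItem-id : ∀ k g → actItem k idS g ≡ g
  actItem-id ι t = subT-id t
  actItem-id (π n) G = trans (sub-ext (liftSι-id n) G) (sub-id G)

  mapItems-comp : ∀ τ υ vs G → mapItems τ vs (mapItems υ vs G) ≡ mapItems (τ ⊙ υ) vs G
  mapItems-comp τ υ [] [] = refl
  mapItems-comp τ υ (k ∷ ks) (g ∷ gs) = cong₂ _∷_ (actItem-comp k τ υ g) (mapItems-comp τ υ ks gs)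

  mapItems-ext : ∀ {τ τ'} vs G → τ ≈S τ' → mapItems τ vs G ≡ mapItems τ' vs G
  mapItems-ext [] [] e = refl
  mapItems-ext (k ∷ ks) (g ∷ gs) e = cong₂ _∷_ (actItem-ext k g e) (mapItems-ext ks gs e)

  mapItems-id : ∀ vs G → mapItems idS vs G ≡ G
  mapItems-id [] [] = refl
  mapItems-id (k ∷ ks) (g ∷ gs) = cong₂ _∷_ (actItem-id k g) (mapItems-id ks gs)

  lift*-instS : ∀ vs σ → lift* vs σ ≈S instS vs (weakS vs ⊙ σ) (idItems vs)
  lift*-instS vs σ = ≈trans (≈sym (⊙-idl (lift* vs σ)))
    (≈trans (⊙-ext {idS} {instS vs (weakS vs) (idItems vs)} {lift* vs σ} {lift* vs σ} (≈sym (seqS-id vs)) ≈refl) (instS-lift vs (weakS vs) (idItems vs) σ))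

  singleι-weakK : ∀ t → (single ι t ⊙ weakK ι) ≈S idS
  singleι-weakK t = ≈trans (⊙-ext {single ι t} {extS ι idS t} {weakK ι} {weakK ι} (single-extS ι t) ≈refl)
      (extS-weakK ι idS t)

  -- Opening the prefix vs: Φ replaces the variables of vs by fresh ones so that the term
  -- variable just below vs can be instantiated from outside; singleι-opened expresses
  -- sub (lift* vs (single ι t)) through Φ.
  module OpenPrefix (vs : List Kind) where
    W : Subst
    W = weakK ι ⊙ weakS vs
    freshItems : All Item vs
    freshItems = mapItems (weakK ι) vs (idItems vs)
    Φ : Subst
    Φ = instS vs (extS ι W (var 0)) freshItems

    single-after-Φ : ∀ t → (single ι t ⊙ Φ) ≈S instS vs (extS ι (weakS vs) t) (idItems vs)
    single-after-Φ t = ≈trans (instS-⊙ vs (single ι t) (extS ι W (var 0)) freshItems)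
      (subst (λ G → instS vs (single ι t ⊙ extS ι W (var 0)) (mapItems (single ι t) vs freshItems) ≈S instS vs (extS ι (weakS vs) t) G) fresh-inst
        (instS-ext vs _ (≈trans (⊙-extS ι (single ι t) W (var 0)) (extS-ext ι t
          (≈trans (≈sym (⊙-assoc (single ι t) (weakK ι) (weakS vs)))
            (≈trans (⊙-ext {single ι t ⊙ weakK ι} {idS} {weakS vs} {weakS vs} (singleι-weakK t) ≈refl)
                (⊙-idl (weakS vs))))))))
      where
      fresh-inst : mapItems (single ι t) vs freshItems ≡ idItems vs
      fresh-inst = trans (mapItems-comp _ _ vs (idItems vs)) (trans (mapItems-ext vs (idItems vs) (singleι-weakK t))
          (mapItems-id vs (idItems vs)))

    weakenT : Term → Term
    weakenT t = subT (ind (weakS vs)) t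

    singleι-opened : ∀ t X → sub (lift* vs (single ι t)) X ≡ sub (single ι (weakenT t)) (sub Φ X)
    singleι-opened t X = trans (sub-ext
        (≈trans (lift*-instS vs (single ι t)) (instS-ext vs (idItems vs) (⊙-single ι (weakS vs) t))) X)
      (trans (sub-ext (≈sym (single-after-Φ (weakenT t))) X) (sym (sub-comp _ _ X)))

    WFS-Φ : WFS Φ
    WFS-Φ = WFS-instS vs (extS ι W (var 0)) freshItems (WFS-extS ι W (var 0)
      (λ n i → WF-sub (liftSι n (weakK ι)) (WFS-liftSι n (weakK ι) (WFS-weakK ι)) (prd (weakS vs) n i) pvar) tt)
      (WFSeq-mapItems (weakK ι) vs (idItems vs) (WFS-weakK ι) (WFSeq-idItems vs))

  seqS-empty : ∀ X → sub (seqS [] [] []) X ≡ X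
  seqS-empty X = trans (sub-ext weakS-nil X) (sub-id X)

module InclusionUnderSubstitution (S : Signature) (E : Syntax.Term S → Syntax.Term S → Set) where
  open Syntax S
  open Inclusion E renaming (trans to ⊆-trans)
  open Substitution S
  open Polarity S
  open FixedPointSubstitutions S
  open ArrowTypes S

  Particular-sym : ∀ {u w} → Particular u w → Particular w u
  Particular-sym (fwd e ρ) = bwd e ρ
  Particular-sym (bwd e ρ) = fwd e ρ

  Particular-sub : ∀ ρ {u w} → Particular u w → Particular (subT ρ u) (subT ρ w)
  Particular-sub ρ (fwd {l} {r} e ρ') = subst₂ Particular (sym (subT-comp ρ ρ' l)) (sym (subT-comp ρ ρ' r)) (fwd e (ρ ⊚ ρ'))
  Particular-sub ρ (bwd {l} {r} e ρ') = subst₂ Particular (sym (subT-comp ρ ρ' r)) (sym (subT-comp ρ ρ' l)) (bwd e (ρ ⊚ ρ'))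

  ⊆-sub : ∀ σ → WFS σ → ∀ {A B} → A ⊆ B → sub σ A ⊆ sub σ B
  ⊆-sub σ h (ax {A} w) = ax (WF-sub σ h A w)
  ⊆-sub σ h (arr p q) = arr (⊆-sub σ h p) (⊆-sub σ h q)
  ⊆-sub σ h (∀ιl {A} {B} t p) = ∀ιl (subT (ind σ) t) (subst (_⊆ sub σ B) (sub-singleι σ t A) (⊆-sub σ h p))
  ⊆-sub σ h (∀πl {n} {A} {B} G p) = ∀πl (sub (liftSι n σ) G) (subst (_⊆ sub σ B) (sub-singleπ σ n G A) (⊆-sub σ h p))
  ⊆-sub σ h (∀ιr {A} {B} p) = ∀ιr (subst (_⊆ sub (liftSι 1 σ) B) (wkι-comm 1 σ A) (⊆-sub (liftSι 1 σ) (WFS-liftSι 1 σ h) p))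
  ⊆-sub σ h (∀πr {n} {A} {B} p) = ∀πr (subst (_⊆ sub (liftSπ n σ) B) (wkπ-comm n σ A)
      (⊆-sub (liftSπ n σ) (WFS-liftSπ n σ h) p))
  ⊆-sub σ h (eqn {A} {B} {u} {w} pw p) = subst (sub σ A ⊆_) (sym (sub-singleι σ w B))
    (eqn {B = sub (liftSι 1 σ) B} (Particular-sub (ind σ) pw) (subst (sub σ A ⊆_) (sub-singleι σ u B) (⊆-sub σ h p)))
  ⊆-sub σ h (⊆-trans p q) = ⊆-trans (⊆-sub σ h p) (⊆-sub σ h q)
  ⊆-sub σ h (μd {m} {D} {ts} w) = subst (_⊆ sub σ (μ m D ts)) (sym (sub-σd σ m D ts D)) (μd (WF-sub σ h (μ m D ts) w))
  ⊆-sub σ h (μg' {m} {D} {ts} w) = subst (sub σ (μ m D ts) ⊆_) (sym (sub-σd σ m D ts D)) (μg' (WF-sub σ h (μ m D ts) w))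
  ⊆-sub σ h (μg {m} {D} {ts} {F} w p) = subst (sub σ (μ m D ts) ⊆_) (sym (sub-inst σ ts F))
    (μg (WF-sub σ h (μ m D ts) w) (subst (_⊆ sub (liftSι m σ) F) (sub-σg σ m F D) (⊆-sub (liftSι m σ) (WFS-liftSι m σ h) p)))

  ⊆-subι : ∀ ρ {A B} → A ⊆ B → subι ρ A ⊆ subι ρ B
  ⊆-subι ρ {A} {B} p = subst₂ _⊆_ (sym (subι-as-sub ρ A)) (sym (subι-as-sub ρ B)) (⊆-sub (ιS ρ) (λ n i → pvar) p)

  ⊆-renπ : ∀ r {A B} → A ⊆ B → renπ r A ⊆ renπ r B
  ⊆-renπ r {A} {B} p = subst₂ _⊆_ (sym (renπ-as-sub r A)) (sym (renπ-as-sub r B)) (⊆-sub (πS r) (λ n i → pvar) p)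

  WF-⊆ : ∀ {A B} → A ⊆ B → WF A × WF B
  WF-⊆ (ax w) = w , w
  WF-⊆ (arr p q) = (proj₂ (WF-⊆ p) ⇒ proj₁ (WF-⊆ q)) , (proj₁ (WF-⊆ p) ⇒ proj₂ (WF-⊆ q))
  WF-⊆ (∀ιl {A} t p) = ∀ι (WF-sub⁻ _ A (proj₁ (WF-⊆ p))) , proj₂ (WF-⊆ p)
  WF-⊆ (∀πl {n} {A} G p) = ∀π (WF-sub⁻ _ A (proj₁ (WF-⊆ p))) , proj₂ (WF-⊆ p)
  WF-⊆ (∀ιr {A} p) = WF-subι⁻ _ A (proj₁ (WF-⊆ p)) , ∀ι (proj₂ (WF-⊆ p))
  WF-⊆ (∀πr {n} {A} p) = WF-renπ⁻ _ A (proj₁ (WF-⊆ p)) , ∀π (proj₂ (WF-⊆ p))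
  WF-⊆ (eqn {A} {B} {u} {w} pw p) = proj₁ (WF-⊆ p) , WF-sub (single ι w) (WFS-singleι w) B (WF-sub⁻ _ B (proj₂ (WF-⊆ p)))
  WF-⊆ (⊆-trans p q) = proj₁ (WF-⊆ p) , proj₂ (WF-⊆ q)
  WF-⊆ (μd {m} {D} {ts} w) = WF-sub _ (WFS-σd m D ts w) D (WF-μ-body w) , w
  WF-⊆ (μg' {m} {D} {ts} w) = w , WF-sub _ (WFS-σd m D ts w) D (WF-μ-body w)
  WF-⊆ (μg {m} {D} {ts} {F} w p) = w , WF-subι _ F (proj₂ (WF-⊆ p))

  ∀ι-cong : ∀ {X Y} → X ⊆ Y → ∀ι X ⊆ ∀ι Y
  ∀ι-cong {X} p = ∀ιr (∀ιl (var 0) (subst (_⊆ _) (sym (inst-var0 X)) p))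

  ∀π-cong : ∀ {b X Y} → X ⊆ Y → ∀π b X ⊆ ∀π b Y
  ∀π-cong {b} {X} p = ∀πr (∀πl (idbody b 0) (subst (_⊆ _) (sym (inst-pvar0 b X)) p))

  AT-⊆ : ∀ {A B} → A ⊆ B → ArrowType A → ArrowType B
  AT-⊆ (ax w) a = a
  AT-⊆ (arr p q) a = _ ⇒ _
  AT-⊆ (∀ιl t p) (∀ι a) = AT-⊆ p (AT-sub _ a)
  AT-⊆ (∀πl G p) (∀π a) = AT-⊆ p (AT-sub _ a)
  AT-⊆ (∀ιr p) a = ∀ι (AT-⊆ p (AT-subι _ a))
  AT-⊆ (∀πr p) a = ∀π (AT-⊆ p (AT-renπ _ a))
  AT-⊆ (eqn {B = B0} {w = w} pw p) a = AT-sub (single ι w) (AT-sub⁻ (single ι _) B0 (λ n i ()) (AT-⊆ p a))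
  AT-⊆ (⊆-trans p q) a = AT-⊆ q (AT-⊆ p a)
  AT-⊆ (μd {m} {D} {ts} w) a = μ (AT-unfold⁻ m D ts a)
  AT-⊆ (μg' w) (μ a) = AT-sub _ a
  AT-⊆ (μg w p) (μ a) = AT-subι _ (AT-⊆ p (AT-sub _ a))

  μBody-least : ∀ {m D ts F} → WF (μ m D ts) → sub (σg m F) D ⊆ F → μBody m D ⊆ F
  μBody-least {m} {D} {ts} {F} w p = subst₂ _⊆_ eqMu eqF (μg {m = m} {D = D''} {ts = varsFrom m 0} {F = F''} wμ p'')
    where
    σ = ιS (shiftι m)
    hσ : WFS σ
    hσ n i = pvar
    D'' = sub (liftSι m (liftSπ m σ)) D
    F'' = sub (liftSι m σ) F
    p'' : sub (σg m F'') D'' ⊆ F''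
    p'' = subst (_⊆ F'') (sub-σg σ m F D) (⊆-sub (liftSι m σ) (WFS-liftSι m σ hσ) p)
    wμ : WF (μ m D'' (varsFrom m 0))
    wμ = WF-μ-args (WF-sub σ hσ (μ m D ts) w)
    eqMu : μ m D'' (varsFrom m 0) ≡ μBody m D
    eqMu = cong (λ X → μ m X (varsFrom m 0)) (trans (sub-ext (liftSι-ext m (liftSπ-ιS m (shiftι m))) D)
        (sub-liftιS m (shiftι m) D))
    eqF : subι (inst (varsFrom m 0) var) F'' ≡ F
    eqF = trans (cong (subι _) (sub-liftιS m (shiftι m) F))
      (trans (subι-comp _ _ F) (trans (subι-ext (vars-unshift m) F) (subι-id F)))

module Monotonicity (S : Signature) (E : Syntax.Term S → Syntax.Term S → Set) where
  open Syntax S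
  open Inclusion E renaming (trans to ⊆-trans)
  open Substitution S
  open Polarity S
  open FixedPointSubstitutions S
  open InclusionUnderSubstitution S E

  record Below (σ₁ σ₂ : Subst) (m k : ℕ) : Set where
    constructor mkBelow
    field
      agree : Agree σ₁ σ₂ m k
      below-at : prd σ₁ m k ⊆ prd σ₂ m k
      wf₁ : WFS σ₁
      wf₂ : WFS σ₂
  open Below public

  Below-liftSι : ∀ j {σ₁ σ₂ m k} → Below σ₁ σ₂ m k → Below (liftSι j σ₁) (liftSι j σ₂) m k
  Below-liftSι j {σ₁} {σ₂} r = mkBelow (Agree-liftSι j (agree r)) (⊆-subι _ (below-at r))
    (WFS-liftSι j σ₁ (wf₁ r)) (WFS-liftSι j σ₂ (wf₂ r))

  Below-liftSπ : ∀ b {σ₁ σ₂ m k} → Below σ₁ σ₂ m k → Below (liftSπ b σ₁) (liftSπ b σ₂) m (shiftπ b m k)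
  Below-liftSπ b {σ₁} {σ₂} {m} {k} r = mkBelow (Agree-liftSπ b (agree r))
    (subst₂ _⊆_ (sym (liftSπ-shifted b σ₁ m k)) (sym (liftSπ-shifted b σ₂ m k))
        (⊆-renπ (shiftπ b) (below-at r)))
    (WFS-liftSπ b σ₁ (wf₁ r)) (WFS-liftSπ b σ₂ (wf₂ r))

  Below-⊙ : ∀ τ → WFS τ → ∀ {σ₁ σ₂ m k} → Below σ₁ σ₂ m k → Below (τ ⊙ σ₁) (τ ⊙ σ₂) m k
  Below-⊙ τ h r = mkBelow (Agree-⊙ τ (agree r)) (⊆-sub (liftSι _ τ) (WFS-liftSι _ τ h) (below-at r))
    (λ n i → WF-sub (liftSι n τ) (WFS-liftSι n τ h) _ (wf₁ r n i))
    (λ n i → WF-sub (liftSι n τ) (WFS-liftSι n τ h) _ (wf₂ r n i))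

  Below-lift* : ∀ vs {σ₁ σ₂ m k} → Below σ₁ σ₂ m k → Below (lift* vs σ₁) (lift* vs σ₂) m (shiftK vs m k)
  Below-lift* [] r = r
  Below-lift* (ι ∷ ks) r = Below-lift* ks (Below-liftSι 1 r)
  Below-lift* (π b ∷ ks) r = Below-lift* ks (Below-liftSπ b r)

  -- The instance of the rule μ_g that drives the μ-case of monotonicity: the
  -- closure of D[σ₁] is below that of D[σ₂], since the latter is a pre-fixed
  -- point of D[σ₁] once the bodies are compared under every substitution τ.
  μ-monotone : ∀ b D σ₁ σ₂ (us : Vec Term b) → WF (μ b D us) → WFS σ₁ → WFS σ₂ →
    (∀ τ → WFS τ → sub (τ ⊙ liftSι b (liftSπ b σ₁)) D ⊆ sub (τ ⊙ liftSι b (liftSπ b σ₂)) D) →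
    μ b (sub (liftSι b (liftSπ b σ₁)) D) us ⊆ μ b (sub (liftSι b (liftSπ b σ₂)) D) us
  μ-monotone b D σ₁ σ₂ us w h₁ h₂ cmp = subst (μ b D₁ us ⊆_) (inst-μBody us D₂) (μg w₁ (⊆-trans D₁⊆D₂ D₂⊆Mu₂))
    where
    D₁ = sub (liftSι b (liftSπ b σ₁)) D
    D₂ = sub (liftSι b (liftSπ b σ₂)) D
    Mu₂ = μBody b D₂
    w₁ : WF (μ b D₁ us)
    w₁ = WF-μ-args (WF-sub σ₁ h₁ (μ b D us) w)
    wMu₂ : WF Mu₂
    wMu₂ = WF-μBody b D₂ us (WF-μ-args (WF-sub σ₂ h₂ (μ b D us) w))
    D₁⊆D₂ : sub (σg b Mu₂) D₁ ⊆ sub (σg b Mu₂) D₂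
    D₁⊆D₂ = subst₂ _⊆_ (sym (sub-comp (σg b Mu₂) _ D)) (sym (sub-comp (σg b Mu₂) _ D))
      (cmp (σg b Mu₂) (WFS-replC b _ (WF-subι _ Mu₂ wMu₂)))
    D₂⊆Mu₂ : sub (σg b Mu₂) D₂ ⊆ Mu₂
    D₂⊆Mu₂ = subst (_⊆ Mu₂) (sym (σg-μBody b D₂)) (μd (WF-μ-args wMu₂))

  Ordered : Pol → Fm → Fm → Set
  Ordered pos X Y = X ⊆ Y
  Ordered neg X Y = Y ⊆ X

  Ordered-≡ : ∀ p {X Y} → X ≡ Y → WF X → Ordered p X Y
  Ordered-≡ pos refl w = ax w
  Ordered-≡ neg refl w = ax w

  unaffected : ∀ p {m k} A → WF A → ¬ Occurs m k A → ∀ {σ₁ σ₂} → Below σ₁ σ₂ m k → Ordered p (sub σ₁ A) (sub σ₂ A)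
  unaffected p A w ¬o {σ₁} r = Ordered-≡ p (sub-agree A (agree r) ¬o) (WF-sub σ₁ (wf₁ r) A w)

  sub-monotone : ∀ p {m k} A → WF A → Pl p m k A → ∀ {σ₁ σ₂} → Below σ₁ σ₂ m k → Ordered p (sub σ₁ A) (sub σ₂ A)
  sub-monotone p ⊥' w h r = unaffected p ⊥' w (λ ()) r
  sub-monotone p (pcon P ts) w h r = unaffected p (pcon P ts) w (λ ()) r
  sub-monotone p {m} {k} (pvar n i ts) w h r with Occ? m k (pvar n i ts)
  ... | no ¬o = unaffected p (pvar n i ts) w ¬o r
  sub-monotone pos {m} {k} (pvar _ _ ts) w h {σ₁} {σ₂} r | yes here =
    subst (λ X → subι (inst (subTs (ind σ₁) ts) var) (prd σ₁ m k) ⊆ subι (inst X var) (prd σ₂ m k))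
      (subTs-ext (a-ind (agree r)) ts) (⊆-subι _ (below-at r))
  sub-monotone neg (pvar _ _ ts) w (pvar ¬self) r | yes here = ⊥-elim (¬self (refl , refl))
  sub-monotone pos (A ⇒ B) (wa ⇒ wb) (ha ⇒ hb) r = arr (sub-monotone neg A wa ha r) (sub-monotone pos B wb hb r)
  sub-monotone neg (A ⇒ B) (wa ⇒ wb) (ha ⇒ hb) r = arr (sub-monotone pos A wa ha r) (sub-monotone neg B wb hb r)
  sub-monotone pos (∀ι A) (∀ι w) (∀ι h) r = ∀ι-cong (sub-monotone pos A w h (Below-liftSι 1 r))
  sub-monotone neg (∀ι A) (∀ι w) (∀ι h) r = ∀ι-cong (sub-monotone neg A w h (Below-liftSι 1 r))
  sub-monotone pos (∀π b A) (∀π w) (∀π h) r = ∀π-cong (sub-monotone pos A w h (Below-liftSπ b r))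
  sub-monotone neg (∀π b A) (∀π w) (∀π h) r = ∀π-cong (sub-monotone neg A w h (Below-liftSπ b r))
  sub-monotone pos (μ b D ts) w (μ h) {σ₁} {σ₂} r = subst (λ X → _ ⊆ μ b _ X) (subTs-ext (a-ind (agree r)) ts)
    (μ-monotone b D σ₁ σ₂ _ (WF-μ-args w) (wf₁ r) (wf₂ r)
        (λ τ hτ → sub-monotone pos D (WF-μ-body w) h (Below-⊙ τ hτ (Below-liftSι b (Below-liftSπ b r)))))
  sub-monotone neg (μ b D ts) w (μ h) {σ₁} {σ₂} r = subst (λ X → μ b _ X ⊆ _) (subTs-ext (a-ind (agree r)) ts)
    (μ-monotone b D σ₂ σ₁ _ (WF-μ-args w) (wf₂ r) (wf₁ r)
        (λ τ hτ → sub-monotone neg D (WF-μ-body w) h (Below-⊙ τ hτ (Below-liftSι b (Below-liftSπ b r)))))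

  σg-Below : ∀ {m D ts F} → WF (μ m D ts) → sub (σg m F) D ⊆ F → Below (σg m (μBody m D)) (σg m F) m 0
  σg-Below {m} {D} {ts} {F} w p = mkBelow (mkAg (λ _ → refl) (replC-others m _ _))
    (subst₂ _⊆_ (sym (replC-new m _)) (sym (replC-new m _)) (⊆-subι _ (μBody-least w p)))
    (WFS-replC m _ (WF-subι _ (μBody m D) (WF-μBody m D ts w))) (WFS-replC m _ (WF-subι _ F (proj₂ (WF-⊆ p))))

module RepInclusion (S : Signature) (E : Syntax.Term S → Syntax.Term S → Set) where
  open Syntax S
  open Inclusion E renaming (trans to ⊆-trans)
  open Substitution S
  open Polarity S
  open FixedPointSubstitutions S
  open ArrowTypes S
  open Instantiation S
  open InclusionUnderSubstitution S E
  open Monotonicity S E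

  -- An equation of E may be used below a prefix of binders vs: the prefix is
  -- opened by an instantiation Φ with fresh variables, the equation applied
  -- to the weakened terms, and the result read back under the prefix.
  eqn-under-prefix : ∀ vs {u w} → Particular u w → ∀ X → WF X → sub (lift* vs (single ι u)) X ⊆ sub (lift* vs (single ι w)) X
  eqn-under-prefix vs {u} {w} pw X wx = subst₂ _⊆_ (sym (singleι-opened u X)) (sym (singleι-opened w X))
    (eqn {B = sub Φ X} (Particular-sub (ind (weakS vs)) pw)
      (ax (WF-sub (single ι (weakenT u)) (WFS-single ι (weakenT u) tt) (sub Φ X) (WF-sub Φ WFS-Φ X wx))))
    where
    open OpenPrefix vs

  -- RepIncl vs vs' Ag Ad Bg Bd: the conclusion of the theorem for the
  -- presentations ∀vs(Ag → Ad) and ∀vs'(Bg → Bd), with the instantiation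
  -- [G/vs] written as the substitution seqS vs vs' G.
  RepIncl : List Kind → List Kind → Fm → Fm → Fm → Fm → Set
  RepIncl vs vs' Ag Ad Bg Bd =
    Σ (All Item vs) λ G → WFSeq vs G × (Bg ⊆ sub (seqS vs vs' G) Ag) × (sub (seqS vs vs' G) Ad ⊆ Bd)

  -- Reflexivity: instantiate every variable by itself.
  RepIncl-refl : ∀ vs Ag Ad → WF Ag → WF Ad → RepIncl vs vs Ag Ad Ag Ad
  RepIncl-refl vs Ag Ad wg wd = idItems vs , WFSeq-idItems vs , subst (Ag ⊆_) (sym (eq Ag)) (ax wg) , subst
      (_⊆ Ad) (sym (eq Ad)) (ax wd)
    where
    eq : ∀ X → sub (seqS vs vs (idItems vs)) X ≡ X
    eq X = trans (sub-ext (seqS-id vs) X) (sub-id X)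

  RepIncl-arr : ∀ {A A' B B'} → A ⊆ A' → B ⊆ B' → RepIncl [] [] A' B A B'
  RepIncl-arr {A} {A'} {B} {B'} p q = [] , tt , subst (A ⊆_) (sym (seqS-empty A')) p , subst (_⊆ B') (sym (seqS-empty B)) q

  -- Instantiating the outermost quantifier of the left side by g: prepend
  -- (the weakening of) g to the instantiation.
  RepIncl-instL : ∀ k g vs1 vs' Ag Ad Bg Bd → WFItem k g →
    RepIncl vs1 vs' (sub (lift* vs1 (single k g)) Ag) (sub (lift* vs1 (single k g)) Ad) Bg Bd → RepIncl
        (k ∷ vs1) vs' Ag Ad Bg Bd
  RepIncl-instL k g vs1 vs' Ag Ad Bg Bd wg (G1 , ws , p , q) =
    (g' ∷ G1) , (WFItem-actItem k (weakS vs') g (WFS-weakS vs') wg , ws) , subst (Bg ⊆_) (eq Ag) p , subst (_⊆ Bd) (eq Ad) q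
    where
    g' = actItem k (weakS vs') g
    eq : ∀ X → sub (seqS vs1 vs' G1) (sub (lift* vs1 (single k g)) X) ≡ sub (instS vs1 (extS k (weakS vs') g') G1) X
    eq X = trans (sub-comp _ _ X) (sub-ext
        (≈trans (instS-lift vs1 (weakS vs') G1 (single k g)) (instS-ext vs1 G1 (⊙-single k (weakS vs') g))) X)

  -- Generalising on the right: the instantiation is unchanged, it now lives
  -- under one more variable.
  RepIncl-genR : ∀ k vs vs1' Ag Ad Bg Bd →
    RepIncl vs vs1' (sub (lift* vs (weakK k)) Ag) (sub (lift* vs (weakK k)) Ad) Bg Bd → RepIncl vs (k ∷ vs1') Ag Ad Bg Bd
  RepIncl-genR k vs vs1' Ag Ad Bg Bd (G , ws , p , q) = G , ws , subst (Bg ⊆_) (eq Ag) p , subst (_⊆ Bd) (eq Ad) q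
    where
    eq : ∀ X → sub (seqS vs vs1' G) (sub (lift* vs (weakK k)) X) ≡ sub (seqS vs (k ∷ vs1') G) X
    eq X = trans (sub-comp _ _ X) (sub-ext
        (≈trans (instS-lift vs (weakS vs1') G (weakK k)) (instS-ext vs G (≈sym (weakS-cons k vs1')))) X)

  -- Transitivity: compose the instantiations.
  RepIncl-trans : ∀ vs vsC vs' Ag Ad Cg Cd Bg Bd → RepIncl vs vsC Ag Ad Cg Cd → RepIncl vsC vs' Cg Cd Bg Bd →
      RepIncl vs vs' Ag Ad Bg Bd
  RepIncl-trans vs vsC vs' Ag Ad Cg Cd Bg Bd (G1 , w1 , p1 , q1) (G2 , w2 , p2 , q2) =
    mapItems τ vs G1 , WFSeq-mapItems τ vs G1 hτ w1 ,
    ⊆-trans p2 (subst (sub τ Cg ⊆_) (eq Ag) (⊆-sub τ hτ p1)) ,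
    ⊆-trans (subst (_⊆ sub τ Cd) (eq Ad) (⊆-sub τ hτ q1)) q2
    where
    τ = seqS vsC vs' G2
    hτ : WFS τ
    hτ = WFS-instS vsC (weakS vs') G2 (WFS-weakS vs') w2
    eq : ∀ X → sub τ (sub (seqS vs vsC G1) X) ≡ sub (seqS vs vs' (mapItems τ vs G1)) X
    eq X = trans (sub-comp _ _ X) (sub-ext
        (≈trans (instS-⊙ vs τ (weakS vsC) G1) (instS-ext vs _ (instS-weak vsC (weakS vs') G2))) X)

  RepIncl-sub : ∀ τ → WFS τ → ∀ vs vs' Xg Xd Yg Yd → RepIncl vs vs' Xg Xd Yg Yd →
    RepIncl vs vs' (sub (lift* vs τ) Xg) (sub (lift* vs τ) Xd) (sub (lift* vs' τ) Yg) (sub (lift* vs' τ) Yd)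
  RepIncl-sub τ hτ vs vs' Xg Xd Yg Yd (G , ws , p , q) =
    mapItems L vs G , WFSeq-mapItems L vs G hL ws ,
    subst (sub L Yg ⊆_) (eq Xg) (⊆-sub L hL p) ,
    subst (_⊆ sub L Yd) (eq Xd) (⊆-sub L hL q)
    where
    L = lift* vs' τ
    hL : WFS L
    hL = WFS-lift* vs' τ hτ
    eq : ∀ X → sub L (sub (seqS vs vs' G) X) ≡ sub (seqS vs vs' (mapItems L vs G)) (sub (lift* vs τ) X)
    eq X = trans (sub-comp _ _ X) (trans (sub-ext (≈trans (instS-⊙ vs L (weakS vs') G)
      (≈trans (instS-ext vs _ (weak-nat vs' τ)) (≈sym (instS-lift vs (weakS vs') (mapItems L vs G) τ)))) X)
          (sym (sub-comp _ _ X)))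

  RepIncl-eqn : ∀ vs vs' Ag Ad Bg Bd {u w} → Particular u w → WF Bg → WF Bd →
    RepIncl vs vs' Ag Ad (sub (lift* vs' (single ι u)) Bg) (sub (lift* vs' (single ι u)) Bd) →
    RepIncl vs vs' Ag Ad (sub (lift* vs' (single ι w)) Bg) (sub (lift* vs' (single ι w)) Bd)
  RepIncl-eqn vs vs' Ag Ad Bg Bd pw wg wd (G , ws , p , q) =
    G , ws , ⊆-trans (eqn-under-prefix vs' (Particular-sym pw) Bg wg) p , ⊆-trans q (eqn-under-prefix vs' pw Bd wd)

  -- Replacing σ₂ by a smaller σ₁ on the left, in a variable negative in the
  -- hypothesis and positive in the conclusion, keeps RepIncl (by monotonicity).
  RepIncl-mono : ∀ vs vs' Dg Dd Fg Fd {σ₁ σ₂ m k} → Below σ₁ σ₂ m k →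
    Neg m (shiftK vs m k) Dg → Pos m (shiftK vs m k) Dd → WF Dg → WF Dd →
    RepIncl vs vs' (sub (lift* vs σ₂) Dg) (sub (lift* vs σ₂) Dd) Fg Fd →
    RepIncl vs vs' (sub (lift* vs σ₁) Dg) (sub (lift* vs σ₁) Dd) Fg Fd
  RepIncl-mono vs vs' Dg Dd Fg Fd r ng pd wg wd (G , ws , p , q) =
    G , ws ,
    ⊆-trans p (subst₂ _⊆_ (sym (sub-comp τ _ Dg)) (sym (sub-comp τ _ Dg)) (sub-monotone neg Dg wg ng r')) ,
    ⊆-trans (subst₂ _⊆_ (sym (sub-comp τ _ Dd)) (sym (sub-comp τ _ Dd)) (sub-monotone pos Dd wd pd r')) q
    where
    τ = seqS vs vs' G
    r' = Below-⊙ τ (WFS-instS vs (weakS vs') G (WFS-weakS vs') ws) (Below-lift* vs r)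

  -- A ≼ B: RepIncl holds for all presentations of Rep A and Rep B.  By the
  -- injectivity of ∀* such presentations are unique, so each rule of ⊆ below
  -- only has to be checked on the presentations computed by rep-shape.
  infix 4 _≼_
  record _≼_ (A B : Fm) : Set where
    field
      ≼-reps : ∀ vs Ag Ad vs' Bg Bd → Rep A ≡ ∀* vs (Ag ⇒ Ad) → Rep B ≡ ∀* vs' (Bg ⇒ Bd) → RepIncl vs vs' Ag Ad Bg Bd
  open _≼_ public

  -- Formulas with the same representation: the rules ax, μ_d and μ'_g.
  ≼-same : ∀ {A B X} → WF X → Rep A ≡ X → Rep B ≡ X → A ≼ B
  ≼-same w eA' eB' .≼-reps vs Ag Ad vs' Bg Bd eA eB
    with ∀*-inj vs vs' Ag Ad Bg Bd (trans (sym eA) (trans eA' (trans (sym eB') eB)))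
  ... | refl , refl , refl = RepIncl-refl vs Ag Ad (proj₁ wAD) (proj₂ wAD)
    where
    wAD = WF-∀*⇒ vs (subst WF (trans (sym eA') eA) w)

  ≼-arr : ∀ {A A' B B'} → A ⊆ A' → B ⊆ B' → (A' ⇒ B) ≼ (A ⇒ B')
  ≼-arr {A} {A'} {B} {B'} p q .≼-reps vs Ag Ad vs' Bg Bd eA eB
    with ∀*-inj [] vs A' B Ag Ad eA | ∀*-inj [] vs' A B' Bg Bd eB
  ... | refl , refl , refl | refl , refl , refl = RepIncl-arr p q

  ≼-∀l : ∀ k {A B} g → WFItem k g → ArrowType A → sub (single k g) A ≼ B → ∀K k A ≼ B
  ≼-∀l k {A} g wg at IH .≼-reps vs Ag Ad vs' Bg Bd eA eB with rep-shape at
  ... | vs1 , G1 , D1 , e1 with ∀*-inj (k ∷ vs1) vs G1 D1 Ag Ad (trans (sym (trans (Rep-∀K k A) (cong (∀K k) e1))) eA)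
  ... | refl , refl , refl = RepIncl-instL k g vs1 vs' G1 D1 Bg Bd wg
    (IH .≼-reps vs1 _ _ vs' Bg Bd (Rep-sub-shape (single k g) at vs1 G1 D1 e1) eB)

  -- For a predicate quantifier the witness G must be well formed; if the
  -- variable does not occur, G is irrelevant and ⊥ is used instead.
  ≼-∀πl : ∀ {n A B} G → ArrowType A → WF (sub (single (π n) G) A) → sub (single (π n) G) A ≼ B → ∀π n A ≼ B
  ≼-∀πl {n} {A} {B} G at w IH with Occ? n 0 A
  ... | yes o = ≼-∀l (π n) G (subst WF (replC-new n G) (WF-body (single (π n) G) A w o)) at IH
  ... | no ¬o = ≼-∀l (π n) ⊥' ⊥' at (subst (_≼ B) (sub-agree A (Agree-single n G ⊥') ¬o) IH)

  ≼-∀r : ∀ k {A B} → ArrowType A → ArrowType B → sub (weakK k) A ≼ B → A ≼ ∀K k B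
  ≼-∀r k {A} {B} atA atB IH .≼-reps vs Ag Ad vs' Bg Bd eA eB with rep-shape atB
  ... | vs1' , G' , D' , e1' with ∀*-inj (k ∷ vs1') vs' G' D' Bg Bd (trans (sym (trans (Rep-∀K k B) (cong (∀K k) e1'))) eB)
  ... | refl , refl , refl = RepIncl-genR k vs vs1' Ag Ad G' D'
      (IH .≼-reps vs _ _ vs1' G' D' (Rep-sub-shape (weakK k) atA vs Ag Ad eA) e1')

  ≼-eqn : ∀ {A B u w} → Particular u w → ArrowType B → WF B → A ≼ sub (single ι u) B → A ≼ sub (single ι w) B
  ≼-eqn {B = B} {u} {w} pw atB wB IH .≼-reps vs Ag Ad vs' Bg Bd eA eB with rep-shape atB
  ... | vs0 , G0 , D0 , e0 with ∀*-inj vs0 vs' _ _ Bg Bd (trans (sym (Rep-sub-shape (single ι w) atB vs0 G0 D0 e0)) eB)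
  ... | refl , refl , refl = RepIncl-eqn vs vs0 Ag Ad G0 D0 pw (proj₁ wGD) (proj₂ wGD)
    (IH .≼-reps vs Ag Ad vs0 _ _ eA (Rep-sub-shape (single ι u) atB vs0 G0 D0 e0))
    where
    wGD = WF-Rep-parts vs0 G0 D0 wB atB e0

  ≼-trans : ∀ {A B C} → ArrowType C → A ≼ C → C ≼ B → A ≼ B
  ≼-trans atC p q .≼-reps vs Ag Ad vs' Bg Bd eA eB with rep-shape atC
  ... | vsC , Cg , Cd , eC = RepIncl-trans vs vsC vs' Ag Ad Cg Cd Bg Bd (p .≼-reps vs Ag Ad vsC Cg Cd eA eC)
      (q .≼-reps vsC Cg Cd vs' Bg Bd eC eB)

  -- Rep (μ C x̄ D ⟨t̄⟩) is Rep D with the closure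
  -- μBody for C and t̄ for x̄; the premise gives the statement with F for C.
  -- Monotonicity (C is negative in D_g and positive in D_d) replaces F by the
  -- smaller closure, and substituting t̄ for x̄ yields the conclusion.
  ≼-μg : ∀ {m D ts F} → WF (μ m D ts) → ArrowType D → sub (σg m F) D ⊆ F → sub (σg m F) D ≼ F →
      μ m D ts ≼ subι (inst ts var) F
  ≼-μg {m} {D} {ts} {F} w aD p IH .≼-reps vs Ag Ad vs' Bg Bd eA eB
    with rep-shape aD | rep-shape (AT-⊆ p (AT-sub (σg m F) aD))
  ... | vsD , Dg , Dd , eD | vsF , Fg , Fd , eF
    with ∀*-inj vsD vs _ _ Ag Ad (trans (sym (Rep-μ-shape m D ts vsD Dg Dd eD)) eA)
       | ∀*-inj vsF vs' _ _ Bg Bd (trans (sym (trans (cong Rep (subι-as-sub _ F)) (Rep-sub-shape ρ atF vsF Fg Fd eF))) eB)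
    where
    ρ = ιS (inst ts var)
    atF = AT-⊆ p (AT-sub (σg m F) aD)
  ... | refl , refl , refl | refl , refl , refl =
    RepIncl-sub (ιS (inst ts var)) (λ n i → pvar) vsD vsF (sub (lift* vsD σ) Dg) (sub (lift* vsD σ) Dd) Fg Fd
      (RepIncl-mono vsD vsF Dg Dd Fg Fd (σg-Below w p) (proj₁ polD) (proj₂ polD) (proj₁ wfD) (proj₂ wfD)
        (IH .≼-reps vsD _ _ vsF Fg Fd (Rep-sub-shape (σg m F) aD vsD Dg Dd eD) eF))
    where
    σ = σg m (μBody m D)
    polD = Pos-Rep-parts vsD Dg Dd (WF-μ-body w) aD (WF-μ-pos w) eD
    wfD = WF-Rep-parts vsD Dg Dd (WF-μ-body w) aD eD

  repIncl : ∀ {A B} → A ⊆ B → ArrowType A → A ≼ B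
  repIncl (ax w) at = ≼-same (WF-Rep w at) refl refl
  repIncl (arr p q) at = ≼-arr p q
  repIncl (∀ιl t p) (∀ι at) = ≼-∀l ι t tt at (repIncl p (AT-sub _ at))
  repIncl (∀πl G p) (∀π at) = ≼-∀πl G at (proj₁ (WF-⊆ p)) (repIncl p (AT-sub _ at))
  repIncl (∀ιr {A} p) at = ≼-∀r ι at (AT-⊆ p (AT-subι _ at))
      (subst (_≼ _) (subι-as-sub (shiftι 1) A) (repIncl p (AT-subι _ at)))
  repIncl (∀πr {n} {A} p) at = ≼-∀r (π n) at (AT-⊆ p (AT-renπ _ at))
      (subst (_≼ _) (renπ-as-sub (shiftπ n) A) (repIncl p (AT-renπ _ at)))
  repIncl (eqn {B = B} {u} pw p) at =
    ≼-eqn pw (AT-sub⁻ (single ι u) B (λ n i ()) (AT-⊆ p at)) (WF-sub⁻ (single ι u) B (proj₂ (WF-⊆ p))) (repIncl p at)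
  repIncl (⊆-trans p q) at = ≼-trans (AT-⊆ p at) (repIncl p at) (repIncl q (AT-⊆ p at))
  repIncl (μd {m} {D} {ts} w) at = ≼-same (WF-Rep w (μ aD)) (Rep-sub (σd m D ts) aD) refl
    where
    aD = AT-unfold⁻ m D ts at
  repIncl (μg' {m} {D} {ts} w) (μ aD) = ≼-same (WF-Rep w (μ aD)) refl (Rep-sub (σd m D ts) aD)
  repIncl (μg w p) (μ aD) = ≼-μg w aD p (repIncl p (AT-sub _ aD))


theorem4p1 : (S : Signature) → let open Syntax S in
    (E : Term → Term → Set) → let open Inclusion E in
    (A B : Fm) → WF A → WF B → ArrowType A → ArrowType B →
    (vs vs' : List Kind) (Ag Ad Bg Bd : Fm) →
    Rep A ≡ ∀* vs (Ag ⇒ Ad) → Rep B ≡ ∀* vs' (Bg ⇒ Bd) →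
    A ⊆ B →
    Σ (All Item vs) (λ G → WFSeq vs G ×
    (Bg ⊆ substSeq vs vs' G Ag) × (substSeq vs vs' G Ad ⊆ Bd))
theorem4p1 S E A B _ _ atA _ vs vs' Ag Ad Bg Bd eA eB A⊆B =
  let (G , wfG , Bg⊆Ag[G] , Ad[G]⊆Bd) = ≼-reps (repIncl A⊆B atA) vs Ag Ad vs' Bg Bd eA eB
  in G , wfG , subst (Bg ⊆_) (sym (substSeq-seqS vs vs' G Ag)) Bg⊆Ag[G] ,
     subst (_⊆ Bd) (sym (substSeq-seqS vs vs' G Ad)) Ad[G]⊆Bd
  where
  open Syntax S
  open Inclusion E
  open Instantiation S using (substSeq-seqS)
  open RepInclusion S E using (repIncl; ≼-reps)
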